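{- Let $p$ be an integer with $p\ge 3$ and let $H$ be a simple graph of order $p+4$ not containing $B_p$ as a subgraph. Then $H$ has size $\mathrm{ex}(p+4,B_p)$ if and only if $H=\overline{K_2+C_{i_1}+C_{i_2}+\cdots+C_{i_t}}$ where $i_j\ne 4$ for each $j$ and $i_1+i_2+\cdots+i_t=p+2$.
   Context: Graphs are finite and simple; equality of graphs means isomorphism. The book $B_p$ is the graph consisting of $p$ triangles sharing a common edge. For a graph $H$ and positive integer $n$, $\mathrm{ex}(n,H)$ is the maximum number of edges of a simple graph of order $n$ not containing $H$ as a subgraph. $+$ denotes disjoint union, $\overline{G}$ the complement, $K_2$ a single edge, and $C_s$ the cycle of length $s$ ($s\ge 3$). -}

module Defs where

open import Data.Bool using (Bool; true; false; _∧_; _∨_; not; if_then_else_)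
open import Data.Bool.Properties using (∨-comm; ∧-zeroʳ)
open import Data.Nat using (ℕ; zero; suc; _+_; _≤_; _<ᵇ_; _≡ᵇ_)
open import Data.Fin using (Fin; toℕ; splitAt; _≟_)
open import Data.List using (List; []; _∷_; map; allFin)
open import Data.Nat.ListAction using (sum)
open import Data.Sum using (inj₁; inj₂)
open import Data.Product using (Σ; _×_; _,_)
open import Function using (Injective)
open import Function.Bundles using (_↔_; Inverse)
open import Relation.Nullary using (¬_; yes; no)
open import Relation.Nullary.Decidable using (⌊_⌋)
open import Relation.Binary.PropositionalEquality using (_≡_; refl; sym; cong₂)

record Graph (n : ℕ) : Set where
  field
    adj    : Fin n → Fin n → Bool
    adj-sym    : ∀ i j → adj i j ≡ adj j i
    adj-irrefl : ∀ i → adj i i ≡ false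
open Graph public

private
  neq : ∀ {n} → Fin n → Fin n → Bool
  neq i j = not ⌊ i ≟ j ⌋

  neq-sym : ∀ {n} (i j : Fin n) → neq i j ≡ neq j i
  neq-sym i j with i ≟ j | j ≟ i
  ... | yes _ | yes _ = refl
  ... | no _  | no _  = refl
  ... | yes p | no q  = Data.Empty.⊥-elim (q (sym p))
    where import Data.Empty
  ... | no p  | yes q = Data.Empty.⊥-elim (p (sym q))
    where import Data.Empty

  neq-irr : ∀ {n} (i : Fin n) → neq i i ≡ false
  neq-irr i with i ≟ i
  ... | yes _ = refl
  ... | no ¬p = Data.Empty.⊥-elim (¬p refl)
    where import Data.Empty

mk : ∀ {n} → (Fin n → Fin n → Bool) → Graph n
mk r = record
  { adj = λ i j → (r i j ∨ r j i) ∧ neq i j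
  ; adj-sym = λ i j → cong₂ _∧_ (∨-comm (r i j) (r j i)) (neq-sym i j)
  ; adj-irrefl = λ i → Relation.Binary.PropositionalEquality.trans
      (cong₂ _∧_ refl (neq-irr i)) (∧-zeroʳ (r i i ∨ r i i))
  }

complement : ∀ {n} → Graph n → Graph n
complement G = mk (λ i j → not (adj G i j))

_⊕_ : ∀ {m n} → Graph m → Graph n → Graph (m + n)
_⊕_ {m} G G′ = mk r
  where
    r : Fin (m + _) → Fin (m + _) → Bool
    r i j with splitAt m i | splitAt m j
    ... | inj₁ a | inj₁ b = adj G a b
    ... | inj₂ a | inj₂ b = adj G′ a b
    ... | _      | _      = false

empty0 : Graph 0
empty0 = mk (λ _ _ → false)

K2 : Graph 2
K2 = mk (λ _ _ → true)

-- The cycle C_s on vertices 0,…,s-1 (edges {k,k+1} and {0,s-1});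
-- this is the cycle of length s when s ≥ 3.
Cycle : (s : ℕ) → Graph s
Cycle s = mk (λ i j → (suc (toℕ i) ≡ᵇ toℕ j) ∨ ((toℕ i ≡ᵇ 0) ∧ (suc (toℕ j) ≡ᵇ s)))

cycles : (l : List ℕ) → Graph (sum l)
cycles []      = empty0
cycles (s ∷ l) = Cycle s ⊕ cycles l

-- The book B_p: p triangles sharing the common edge {0,1}.
-- Vertices 0,1 are the spine; every edge has an endpoint in the spine.
Book : (p : ℕ) → Graph (2 + p)
Book p = mk (λ i j → toℕ i <ᵇ 2)

edges : ∀ {n} → Graph n → ℕ
edges {n} G = sum (map (λ i → sum (map (λ j →
  if adj G i j ∧ (toℕ i <ᵇ toℕ j) then 1 else 0) (allFin n))) (allFin n))

Contains : ∀ {n m} → Graph n → Graph m → Set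
Contains {n} {m} G F =
  Σ (Fin m → Fin n) λ f → Injective _≡_ _≡_ f ×
    (∀ i j → adj F i j ≡ true → adj G (f i) (f j) ≡ true)

-- Graph isomorphism ("equality of graphs").
Iso : ∀ {n m} → Graph n → Graph m → Set
Iso {n} {m} G G′ =
  Σ (Fin n ↔ Fin m) λ φ → ∀ i j → adj G i j ≡ adj G′ (Inverse.to φ i) (Inverse.to φ j)

IsEx : (n : ℕ) → ∀ {m} → Graph m → ℕ → Set
IsEx n F e =
  (Σ (Graph n) λ G → ¬ Contains G F × edges G ≡ e) ×
  (∀ (G : Graph n) → ¬ Contains G F → edges G ≤ e)

-- Let K be the complement of H and n = p + 4. The common neighbours of an edge uv of H are all
-- vertices except u, v and N_K(u) ∪ N_K(v), so H is B_p-free iff every non-edge uv of K has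
-- |N_K(u) ∪ N_K(v)| ≥ 3. As 2 e(H) + Σ deg_K = n(n - 1), maximising e(H) means minimising Σ deg_K.
-- Under that condition Σ deg_K ≥ 2(n - 1): an isolated vertex forces all other degrees to be ≥ 3, and
-- a vertex u of degree 1 with neighbour w forces every vertex outside {u, w} to have degree ≥ 2.
-- Equality forces K to be the edge uw plus a 2-regular graph, i.e. a disjoint union of cycles, and
-- none of them is a C₄, where opposite vertices have the same two neighbours. K₂ + C_{p+2} attains
-- the bound, which therefore equals the extremal value.

module Submission where

open import Defs
open import Data.Bool using (Bool; true; false; _∧_; _∨_; not; if_then_else_; T)
open import Data.Unit using (tt)
open import Data.Empty using (⊥; ⊥-elim)
open import Data.Fin using (Fin; zero; suc; toℕ; _≟_; splitAt; _↑ˡ_; _↑ʳ_; fromℕ<; fromℕ; inject₁; inject≤; punchIn)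
open import Data.Fin.Properties
  using ( suc-injective; toℕ-injective; punchInᵢ≢i; toℕ<n; toℕ-fromℕ<; toℕ-fromℕ; toℕ-inject₁; any?; injective⇒≤
        ; inject≤-injective; splitAt-↑ˡ; splitAt-↑ʳ; splitAt⁻¹-↑ˡ; splitAt⁻¹-↑ʳ; ↑ˡ-injective; ↑ʳ-injective)
open import Data.List using (List; []; _∷_; map; allFin; tabulate)
open import Data.List.Properties using (map-tabulate)
open import Data.List.Relation.Unary.All using (All; []; _∷_) renaming (map to All-map)
open import Data.Nat using (ℕ; zero; suc; _+_; _*_; _≤_; _<_; z≤n; s≤s; _<ᵇ_; _≡ᵇ_; _<?_; _≤?_)
open import Data.Nat.ListAction using (sum)
open import Data.Nat.Properties hiding (_≟_; suc-injective)
import Data.Nat.Properties as ℕ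
open import Data.Nat.Tactic.RingSolver using (solve-∀)
open import Data.Product using (Σ; _×_; _,_; proj₁; proj₂)
import Data.Sum
open import Data.Sum using (_⊎_; inj₁; inj₂; [_,_])
open import Function using (_∘_; Injective)
open import Function.Bundles using (_⇔_; Equivalence; Inverse; mk↔ₛ′; mk⇔)
open import Relation.Nullary using (¬_; yes; no)
open import Relation.Nullary.Decidable using (⌊_⌋)
open import Relation.Binary.PropositionalEquality hiding ([_])
open import Algebra.Properties.CommutativeMonoid.Sum +-0-commutativeMonoid
  using (∑-distrib-+; ∑-comm; sum-permute; sum-remove) renaming (sum to ∑; sum-cong-≗ to ∑-cong)

∧-≡-true : ∀ {x y} → x ∧ y ≡ true → x ≡ true × y ≡ true
∧-≡-true {true} y≡true = refl , y≡true

∨-≡-false : ∀ {x y} → x ∨ y ≡ false → x ≡ false × y ≡ false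
∨-≡-false {false} y≡false = refl , y≡false

not-≡-true : ∀ {x} → not x ≡ true → x ≡ false
not-≡-true {false} _ = refl

≡ᵇ-true⇒≡ : ∀ {m n} → (m ≡ᵇ n) ≡ true → m ≡ n
≡ᵇ-true⇒≡ {m} {n} eq = ≡ᵇ⇒≡ m n (subst T (sym eq) tt)

≡⇒≡ᵇ-true : ∀ {m n} → m ≡ n → (m ≡ᵇ n) ≡ true
≡⇒≡ᵇ-true {m} {n} eq with m ≡ᵇ n | ≡⇒≡ᵇ m n eq
... | true | _ = refl

∨-≡-true : ∀ {x y} → (x ∨ y) ≡ true → x ≡ true ⊎ y ≡ true
∨-≡-true {true}  _        = inj₁ refl
∨-≡-true {false} y≡true = inj₂ y≡true

∨-≡-trueˡ : ∀ {x} y → x ≡ true → (x ∨ y) ≡ true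
∨-≡-trueˡ y refl = refl

∨-≡-trueʳ : ∀ x {y} → y ≡ true → (x ∨ y) ≡ true
∨-≡-trueʳ true  _       = refl
∨-≡-trueʳ false y≡true = y≡true

bool-ext : ∀ {x y : Bool} → (x ≡ true → y ≡ true) → (y ≡ true → x ≡ true) → x ≡ y
bool-ext {true}  {true}  _    _    = refl
bool-ext {true}  {false} x⇒y _    = sym (x⇒y refl)
bool-ext {false} {true}  _    y⇒x = y⇒x refl
bool-ext {false} {false} _    _    = refl

∑-mono-≤ : ∀ {n} (f g : Fin n → ℕ) → (∀ i → f i ≤ g i) → ∑ f ≤ ∑ g
∑-mono-≤ {zero}  f g f≤g = z≤n
∑-mono-≤ {suc n} f g f≤g = +-mono-≤ (f≤g zero) (∑-mono-≤ (f ∘ suc) (g ∘ suc) (f≤g ∘ suc))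

∑-const : ∀ n c → ∑ {n} (λ _ → c) ≡ n * c
∑-const zero    c = refl
∑-const (suc n) c = cong (c +_) (∑-const n c)

∑-double : ∀ n → ∑ {n} (λ _ → 2) ≡ n + n
∑-double n = trans (∑-const n 2) (trans (*-comm n 2) (cong (n +_) (+-identityʳ n)))

∑-splitAt : ∀ m k (h : Fin (m + k) → ℕ) → ∑ h ≡ ∑ (λ a → h (a ↑ˡ k)) + ∑ (λ b → h (m ↑ʳ b))
∑-splitAt zero    k h = refl
∑-splitAt (suc m) k h = trans (cong (h zero +_) (∑-splitAt m k (h ∘ suc))) (sym (+-assoc (h zero) _ _))

∑-tight : ∀ {n} (f g : Fin n → ℕ) → (∀ i → f i ≤ g i) → ∑ g ≤ ∑ f → ∀ i → f i ≡ g i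
∑-tight {suc n} f g f≤g ∑g≤∑f zero = ≤-antisym (f≤g zero)
  (+-cancelʳ-≤ (∑ (f ∘ suc)) (g zero) (f zero)
    (≤-trans (+-monoʳ-≤ (g zero) (∑-mono-≤ (f ∘ suc) (g ∘ suc) (f≤g ∘ suc))) ∑g≤∑f))
∑-tight {suc n} f g f≤g ∑g≤∑f (suc i) = ∑-tight (f ∘ suc) (g ∘ suc) (f≤g ∘ suc)
  (+-cancelˡ-≤ (f zero) (∑ (g ∘ suc)) (∑ (f ∘ suc))
    (≤-trans (+-monoˡ-≤ (∑ (g ∘ suc)) (f≤g zero)) ∑g≤∑f)) i

sum-map-allFin : ∀ n (g : Fin n → ℕ) → sum (map g (allFin n)) ≡ ∑ g
sum-map-allFin n g = trans (cong sum (map-tabulate (λ x → x) g)) (tabulated n g)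
  where
  tabulated : ∀ n (h : Fin n → ℕ) → sum (tabulate h) ≡ ∑ h
  tabulated zero    h = refl
  tabulated (suc n) h = cong (h zero +_) (tabulated n (h ∘ suc))

infix 4 _≟ᵇ_

_≟ᵇ_ : ∀ {n} → Fin n → Fin n → Bool
i ≟ᵇ j = ⌊ i ≟ j ⌋

≟ᵇ-refl : ∀ {n} (i : Fin n) → (i ≟ᵇ i) ≡ true
≟ᵇ-refl i with i ≟ i
... | yes _  = refl
... | no i≢i = ⊥-elim (i≢i refl)

≟ᵇ-≢ : ∀ {n} {i j : Fin n} → i ≢ j → (i ≟ᵇ j) ≡ false
≟ᵇ-≢ {i = i} {j} i≢j with i ≟ j
... | yes i≡j = ⊥-elim (i≢j i≡j)
... | no _    = refl

≟ᵇ-cong : ∀ {n m} {x y : Fin n} {x′ y′ : Fin m} →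
  (x ≡ y → x′ ≡ y′) → (x′ ≡ y′ → x ≡ y) → (x ≟ᵇ y) ≡ (x′ ≟ᵇ y′)
≟ᵇ-cong {x = x} {y} {x′} {y′} to from with x ≟ y | x′ ≟ y′
... | yes _ | yes _ = refl
... | no _  | no _  = refl
... | yes p | no q  = ⊥-elim (q (to p))
... | no p  | yes q = ⊥-elim (p (from q))

not-≟ᵇ⇒≢ : ∀ {n} {x y : Fin n} → not (x ≟ᵇ y) ≡ true → x ≢ y
not-≟ᵇ⇒≢ {x = x} x≠y refl rewrite ≟ᵇ-refl x with () ← x≠y

boolToℕ : Bool → ℕ
boolToℕ b = if b then 1 else 0

count : ∀ {n} → (Fin n → Bool) → ℕ
count f = ∑ (λ i → boolToℕ (f i))

count-cong : ∀ {n} (f g : Fin n → Bool) → (∀ i → f i ≡ g i) → count f ≡ count g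
count-cong f g f≗g = ∑-cong (λ i → cong boolToℕ (f≗g i))

count-mono : ∀ {n} (f g : Fin n → Bool) → (∀ i → f i ≡ true → g i ≡ true) → count f ≤ count g
count-mono f g f⇒g = ∑-mono-≤ _ _ λ i → boolToℕ-mono (f i) (g i) (f⇒g i)
  where
  boolToℕ-mono : ∀ x y → (x ≡ true → y ≡ true) → boolToℕ x ≤ boolToℕ y
  boolToℕ-mono true  y x⇒y rewrite x⇒y refl = ≤-refl
  boolToℕ-mono false y x⇒y = z≤n

count-∨ : ∀ {n} (f g : Fin n → Bool) → count (λ i → f i ∨ g i) ≤ count f + count g
count-∨ f g = ≤-trans (∑-mono-≤ _ _ (λ i → boolToℕ-∨ (f i) (g i)))
  (≤-reflexive (∑-distrib-+ (λ i → boolToℕ (f i)) (λ i → boolToℕ (g i))))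
  where
  boolToℕ-∨ : ∀ x y → boolToℕ (x ∨ y) ≤ boolToℕ x + boolToℕ y
  boolToℕ-∨ true  y = s≤s z≤n
  boolToℕ-∨ false y = ≤-refl

count-∨-disjoint : ∀ {n} (f g : Fin n → Bool) → (∀ i → f i ∧ g i ≡ false) →
  count (λ i → f i ∨ g i) ≡ count f + count g
count-∨-disjoint f g disjoint =
  trans (∑-cong (λ i → boolToℕ-∨ (f i) (g i) (disjoint i)))
        (∑-distrib-+ (λ i → boolToℕ (f i)) (λ i → boolToℕ (g i)))
  where
  boolToℕ-∨ : ∀ x y → x ∧ y ≡ false → boolToℕ (x ∨ y) ≡ boolToℕ x + boolToℕ y
  boolToℕ-∨ true  false _ = refl
  boolToℕ-∨ false y     _ = refl

count-+-count-not : ∀ {n} (f : Fin n → Bool) → count f + count (not ∘ f) ≡ n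
count-+-count-not {n} f = begin
  count f + count (not ∘ f)                         ≡⟨ ∑-distrib-+ (λ i → boolToℕ (f i)) (λ i → boolToℕ (not (f i))) ⟨
  ∑ (λ i → boolToℕ (f i) + boolToℕ (not (f i)))     ≡⟨ ∑-cong (λ i → complementary (f i)) ⟩
  ∑ {n} (λ _ → 1)                                   ≡⟨ ∑-const n 1 ⟩
  n * 1                                             ≡⟨ *-identityʳ n ⟩
  n                                                 ∎
  where
  open ≡-Reasoning
  complementary : ∀ x → boolToℕ x + boolToℕ (not x) ≡ 1
  complementary true  = refl
  complementary false = refl

count-false : ∀ {n} (f : Fin n → Bool) → (∀ i → f i ≡ false) → count f ≡ 0
count-false {n} f f≗false = trans (∑-cong (λ i → cong boolToℕ (f≗false i))) (trans (∑-const n 0) (*-zeroʳ n))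

count-≟ᵇ : ∀ {n} (i : Fin n) → count (i ≟ᵇ_) ≡ 1
count-≟ᵇ {suc n} zero    = cong suc (count-false {n} (λ j → zero ≟ᵇ suc j) (λ j → ≟ᵇ-≢ {i = zero} {j = suc j} (λ ())))
count-≟ᵇ {suc n} (suc i) = trans (count-cong (λ j → suc i ≟ᵇ suc j) (i ≟ᵇ_) (λ j → ≟ᵇ-cong suc-injective (cong suc))) (count-≟ᵇ i)

count-≢ : ∀ {n} (i : Fin n) → count (λ j → not (i ≟ᵇ j)) + 1 ≡ n
count-≢ i = trans (+-comm (count (λ j → not (i ≟ᵇ j))) 1)
  (trans (cong (_+ count (λ j → not (i ≟ᵇ j))) (sym (count-≟ᵇ i))) (count-+-count-not (i ≟ᵇ_)))

enumerate : ∀ {n} (f : Fin n → Bool) → Fin (count f) → Fin n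
enumerate {suc n} f k with f zero
enumerate {suc n} f zero    | true  = zero
enumerate {suc n} f (suc k) | true  = suc (enumerate (f ∘ suc) k)
enumerate {suc n} f k       | false = suc (enumerate (f ∘ suc) k)

enumerate-true : ∀ {n} (f : Fin n → Bool) k → f (enumerate f k) ≡ true
enumerate-true {suc n} f k with f zero in f0
enumerate-true {suc n} f zero    | true  = f0
enumerate-true {suc n} f (suc k) | true  = enumerate-true (f ∘ suc) k
enumerate-true {suc n} f k       | false = enumerate-true (f ∘ suc) k

enumerate-injective : ∀ {n} (f : Fin n → Bool) → Injective _≡_ _≡_ (enumerate f)
enumerate-injective {suc n} f {k} {k′} eq with f zero
enumerate-injective {suc n} f {zero}  {zero}   eq | true  = refl
enumerate-injective {suc n} f {suc k} {suc k′} eq | true  = cong suc (enumerate-injective (f ∘ suc) (suc-injective eq))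
enumerate-injective {suc n} f {k}     {k′}     eq | false = enumerate-injective (f ∘ suc) (suc-injective eq)

enumerate-surjective : ∀ {n} (f : Fin n → Bool) i → f i ≡ true → Σ (Fin (count f)) λ k → enumerate f k ≡ i
enumerate-surjective {suc n} f i fi with f zero in f0
enumerate-surjective {suc n} f zero    fi | true  = zero , refl
enumerate-surjective {suc n} f (suc i) fi | true  with enumerate-surjective (f ∘ suc) i fi
... | k , eq = suc k , cong suc eq
enumerate-surjective {suc n} f zero    fi | false with () ← trans (sym f0) fi
enumerate-surjective {suc n} f (suc i) fi | false with enumerate-surjective (f ∘ suc) i fi
... | k , eq = k , cong suc eq

injection⇒≤count : ∀ {m n} (f : Fin n → Bool) (g : Fin m → Fin n) → Injective _≡_ _≡_ g →
  (∀ i → f (g i) ≡ true) → m ≤ count f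
injection⇒≤count f g g-inj f∘g = injective⇒≤ {f = index} index-inj
  where
  index : _ → Fin (count f)
  index i = proj₁ (enumerate-surjective f (g i) (f∘g i))
  index-inj : Injective _≡_ _≡_ index
  index-inj {i} {j} eq = g-inj (trans (sym (proj₂ (enumerate-surjective f (g i) (f∘g i))))
    (trans (cong (enumerate f) eq) (proj₂ (enumerate-surjective f (g j) (f∘g j)))))

≤count⇒injection : ∀ {m n} (f : Fin n → Bool) → m ≤ count f →
  Σ (Fin m → Fin n) λ g → Injective _≡_ _≡_ g × (∀ i → f (g i) ≡ true)
≤count⇒injection f m≤ = (λ i → enumerate f (inject≤ i m≤))
  , (λ eq → inject≤-injective m≤ m≤ _ _ (enumerate-injective f eq))
  , (λ i → enumerate-true f _)

count≡0⇒false : ∀ {n} (f : Fin n → Bool) → count f ≡ 0 → ∀ i → f i ≡ false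
count≡0⇒false f count≡0 i with f i in fi
... | false = refl
... | true  = ⊥-elim (<⇒≱ (injection⇒≤count f (λ (_ : Fin 1) → i) (λ { {zero} {zero} _ → refl }) (λ _ → fi))
                          (≤-reflexive count≡0))

three⇒3≤count : ∀ {n} (f : Fin n → Bool) (x y z : Fin n) → x ≢ y → x ≢ z → y ≢ z →
  f x ≡ true → f y ≡ true → f z ≡ true → 3 ≤ count f
three⇒3≤count f x y z x≢y x≢z y≢z fx fy fz = injection⇒≤count f g g-inj g-true
  where
  g : Fin 3 → _
  g zero             = x
  g (suc zero)       = y
  g (suc (suc zero)) = z
  g-inj : Injective _≡_ _≡_ g
  g-inj {zero}             {zero}             eq = refl
  g-inj {zero}             {suc zero}         eq = ⊥-elim (x≢y eq)
  g-inj {zero}             {suc (suc zero)}   eq = ⊥-elim (x≢z eq)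
  g-inj {suc zero}         {zero}             eq = ⊥-elim (x≢y (sym eq))
  g-inj {suc zero}         {suc zero}         eq = refl
  g-inj {suc zero}         {suc (suc zero)}   eq = ⊥-elim (y≢z eq)
  g-inj {suc (suc zero)}   {zero}             eq = ⊥-elim (x≢z (sym eq))
  g-inj {suc (suc zero)}   {suc zero}         eq = ⊥-elim (y≢z (sym eq))
  g-inj {suc (suc zero)}   {suc (suc zero)}   eq = refl
  g-true : ∀ i → f (g i) ≡ true
  g-true zero             = fx
  g-true (suc zero)       = fy
  g-true (suc (suc zero)) = fz

count≡1⇒unique : ∀ {n} (f : Fin n → Bool) → count f ≡ 1 →
  Σ (Fin n) λ a → f a ≡ true × (∀ c → f c ≡ true → c ≡ a)
count≡1⇒unique f count≡1
  with count f | count≡1 | enumerate f | enumerate-true f | enumerate-surjective f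
... | _ | refl | e | e-true | e-surj =
  e zero , e-true zero , λ c fc → unique (e-surj c fc)
  where
  unique : ∀ {c} → Σ (Fin 1) (λ k → e k ≡ c) → c ≡ e zero
  unique (zero , eq) = sym eq

record ExactlyTwo {n} (f : Fin n → Bool) : Set where
  field
    x y  : Fin n
    x≢y  : x ≢ y
    fx   : f x ≡ true
    fy   : f y ≡ true
    only : ∀ c → f c ≡ true → c ≡ x ⊎ c ≡ y

count≡2⇒exactlyTwo : ∀ {n} (f : Fin n → Bool) → count f ≡ 2 → ExactlyTwo f
count≡2⇒exactlyTwo f count≡2
  with count f | count≡2 | enumerate f | enumerate-injective f | enumerate-true f | enumerate-surjective f
... | _ | refl | e | e-inj | e-true | e-surj = record
  { x = e zero ; y = e (suc zero) ; x≢y = λ eq → 0≢1 (e-inj eq)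
  ; fx = e-true zero ; fy = e-true (suc zero) ; only = λ c fc → only (e-surj c fc) }
  where
  0≢1 : zero ≢ suc zero
  0≢1 ()
  only : ∀ {c} → Σ (Fin 2) (λ k → e k ≡ c) → c ≡ e zero ⊎ c ≡ e (suc zero)
  only (zero , eq)     = inj₁ (sym eq)
  only (suc zero , eq) = inj₂ (sym eq)

exactlyTwo⇒count≡2 : ∀ {n} {f : Fin n → Bool} → ExactlyTwo f → count f ≡ 2
exactlyTwo⇒count≡2 {f = f} T = begin
  count f                                ≡⟨ count-cong f (λ c → (x ≟ᵇ c) ∨ (y ≟ᵇ c)) f≗x∨y ⟩
  count (λ c → (x ≟ᵇ c) ∨ (y ≟ᵇ c))     ≡⟨ count-∨-disjoint (x ≟ᵇ_) (y ≟ᵇ_) disjoint ⟩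
  count (x ≟ᵇ_) + count (y ≟ᵇ_)         ≡⟨ cong₂ _+_ (count-≟ᵇ x) (count-≟ᵇ y) ⟩
  2                                      ∎
  where
  open ≡-Reasoning
  open ExactlyTwo T
  f≗x∨y : ∀ c → f c ≡ ((x ≟ᵇ c) ∨ (y ≟ᵇ c))
  f≗x∨y c with x ≟ c | y ≟ c
  ... | yes refl | _        = fx
  ... | no _     | yes refl = fy
  ... | no x≢c   | no y≢c with f c in fc
  ...   | false = refl
  ...   | true with only c fc
  ...     | inj₁ c≡x = ⊥-elim (x≢c (sym c≡x))
  ...     | inj₂ c≡y = ⊥-elim (y≢c (sym c≡y))
  disjoint : ∀ c → (x ≟ᵇ c) ∧ (y ≟ᵇ c) ≡ false
  disjoint c with x ≟ c | y ≟ c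
  ... | yes refl | yes refl = ⊥-elim (x≢y refl)
  ... | yes _    | no _     = refl
  ... | no _     | _        = refl

exactlyTwo-only : ∀ {n} {f : Fin n → Bool} → ExactlyTwo f → ∀ {a b} → f a ≡ true → f b ≡ true → a ≢ b →
  ∀ c → f c ≡ true → c ≡ a ⊎ c ≡ b
exactlyTwo-only T {a} {b} fa fb a≢b c fc with ExactlyTwo.only T a fa | ExactlyTwo.only T b fb | ExactlyTwo.only T c fc
... | inj₁ p | inj₁ q | _      = ⊥-elim (a≢b (trans p (sym q)))
... | inj₂ p | inj₂ q | _      = ⊥-elim (a≢b (trans p (sym q)))
... | inj₁ p | inj₂ q | inj₁ r = inj₁ (trans r (sym p))
... | inj₁ p | inj₂ q | inj₂ r = inj₂ (trans r (sym q))
... | inj₂ p | inj₁ q | inj₁ r = inj₂ (trans r (sym q))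
... | inj₂ p | inj₁ q | inj₂ r = inj₁ (trans r (sym p))

exactlyTwo-other : ∀ {n} {f : Fin n → Bool} → ExactlyTwo f → ∀ {a} → f a ≡ true →
  Σ (Fin n) λ b → f b ≡ true × b ≢ a
exactlyTwo-other T {a} fa with ExactlyTwo.x T ≟ a
... | yes x≡a = ExactlyTwo.y T , ExactlyTwo.fy T , λ y≡a → ExactlyTwo.x≢y T (trans x≡a (sym y≡a))
... | no x≢a  = ExactlyTwo.x T , ExactlyTwo.fx T , x≢a

degree : ∀ {n} → Graph n → Fin n → ℕ
degree G i = count (adj G i)

adj⇒≢ : ∀ {n} (G : Graph n) {i j} → adj G i j ≡ true → i ≢ j
adj⇒≢ G {i} gij refl with () ← trans (sym (adj-irrefl G i)) gij

handshake : ∀ {n} (G : Graph n) → ∑ (degree G) ≡ edges G + edges G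
handshake {n} G = begin
  ∑ (degree G)                                  ≡⟨ ∑-cong (λ i → trans (∑-cong (split i)) (∑-distrib-+ (forward i) (backward i))) ⟩
  ∑ (λ i → ∑ (forward i) + ∑ (backward i))      ≡⟨ ∑-distrib-+ (λ i → ∑ (forward i)) (λ i → ∑ (backward i)) ⟩
  ∑ (λ i → ∑ (forward i)) + ∑ (λ i → ∑ (backward i))
    ≡⟨ cong₂ _+_ (sym edges≡) (trans (∑-comm backward) (sym edges≡)) ⟩
  edges G + edges G                             ∎
  where
  open ≡-Reasoning
  forward backward : Fin n → Fin n → ℕ
  forward  i j = boolToℕ (adj G i j ∧ (toℕ i <ᵇ toℕ j))
  backward i j = boolToℕ (adj G j i ∧ (toℕ j <ᵇ toℕ i))
  edges≡ : edges G ≡ ∑ (λ i → ∑ (forward i))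
  edges≡ = trans (sum-map-allFin n (λ i → sum (map (forward i) (allFin n))))
                 (∑-cong (λ i → sum-map-allFin n (forward i)))
  <ᵇ-trichotomy : ∀ x y → x ≢ y → boolToℕ (x <ᵇ y) + boolToℕ (y <ᵇ x) ≡ 1
  <ᵇ-trichotomy zero    zero    x≢y = ⊥-elim (x≢y refl)
  <ᵇ-trichotomy zero    (suc y) x≢y = refl
  <ᵇ-trichotomy (suc x) zero    x≢y = refl
  <ᵇ-trichotomy (suc x) (suc y) x≢y = <ᵇ-trichotomy x y (x≢y ∘ cong suc)
  split : ∀ i j → boolToℕ (adj G i j) ≡ forward i j + backward i j
  split i j with adj G i j in gij
  ... | false rewrite adj-sym G j i | gij = refl
  ... | true  rewrite adj-sym G j i | gij =
    sym (<ᵇ-trichotomy (toℕ i) (toℕ j) (adj⇒≢ G gij ∘ toℕ-injective))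

adj-complement : ∀ {n} (G : Graph n) i j → adj (complement G) i j ≡ not (adj G i j) ∧ not (i ≟ᵇ j)
adj-complement G i j rewrite adj-sym G j i with adj G i j
... | true  = refl
... | false = refl

adj-complement-complement : ∀ {n} (G : Graph n) i j → adj (complement (complement G)) i j ≡ adj G i j
adj-complement-complement G i j rewrite adj-complement (complement G) i j | adj-complement G i j
  with adj G i j in gij
... | true rewrite ≟ᵇ-≢ (adj⇒≢ G gij) = refl
... | false with i ≟ j
...   | yes _ = refl
...   | no _  = refl

adj⇒¬adj-complement : ∀ {n} (G : Graph n) {x y} → adj G x y ≡ true → adj (complement G) x y ≡ false
adj⇒¬adj-complement G {x} {y} gxy rewrite adj-complement G x y | gxy = refl

¬adj-complement⇒adj : ∀ {n} (G : Graph n) {x y} → x ≢ y → adj (complement G) x y ≡ false → adj G x y ≡ true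
¬adj-complement⇒adj G {x} {y} x≢y ḡxy rewrite adj-complement G x y | ≟ᵇ-≢ x≢y with adj G x y
... | true  = refl
... | false with () ← ḡxy

degree+degree-complement : ∀ {n} (G : Graph n) i → degree G i + degree (complement G) i + 1 ≡ n
degree+degree-complement G i =
  trans (cong (_+ 1) (trans (sym (count-∨-disjoint (adj G i) (adj (complement G) i) disjoint))
                            (count-cong _ (λ j → not (i ≟ᵇ j)) covers)))
        (count-≢ i)
  where
  disjoint : ∀ j → adj G i j ∧ adj (complement G) i j ≡ false
  disjoint j rewrite adj-complement G i j with adj G i j
  ... | true  = refl
  ... | false = refl
  covers : ∀ j → (adj G i j ∨ adj (complement G) i j) ≡ not (i ≟ᵇ j)
  covers j rewrite adj-complement G i j with adj G i j in gij
  ... | false = refl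
  ... | true rewrite ≟ᵇ-≢ (adj⇒≢ G gij) = refl

edges-complement : ∀ {n} (G : Graph n) → edges G + edges G + ∑ (degree (complement G)) + n ≡ n * n
edges-complement {n} G = begin
  edges G + edges G + ∑ (degree Ḡ) + n
    ≡⟨ cong (λ x → x + ∑ (degree Ḡ) + n) (sym (handshake G)) ⟩
  ∑ (degree G) + ∑ (degree Ḡ) + n
    ≡⟨ cong₂ _+_ (sym (∑-distrib-+ (degree G) (degree Ḡ))) (sym (trans (∑-const n 1) (*-identityʳ n))) ⟩
  ∑ (λ i → degree G i + degree Ḡ i) + ∑ {n} (λ _ → 1)
    ≡⟨ sym (∑-distrib-+ (λ i → degree G i + degree Ḡ i) (λ _ → 1)) ⟩
  ∑ (λ i → degree G i + degree Ḡ i + 1)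
    ≡⟨ ∑-cong (degree+degree-complement G) ⟩
  ∑ {n} (λ _ → n)
    ≡⟨ ∑-const n n ⟩
  n * n ∎
  where
  open ≡-Reasoning
  Ḡ = complement G

-- Book-free graphs of order p + 4

Spread : ∀ {n} → Graph n → Set
Spread {n} K = ∀ (u v : Fin n) → u ≢ v → adj K u v ≡ false → 3 ≤ count (λ w → adj K u w ∨ adj K v w)

book-embedding : ∀ {n p} (H : Graph n) {u v} → adj H u v ≡ true → (g : Fin p → Fin n) → Injective _≡_ _≡_ g →
  (∀ k → u ≢ g k) → (∀ k → v ≢ g k) → (∀ k → adj H u (g k) ≡ true) → (∀ k → adj H v (g k) ≡ true) →
  Contains H (Book p)
book-embedding {p = p} H {u} {v} huv g g-inj u≢g v≢g hug hvg = f , f-inj , f-adj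
  where
  u≢v : u ≢ v
  u≢v = adj⇒≢ H huv
  f : Fin (2 + p) → _
  f zero          = u
  f (suc zero)    = v
  f (suc (suc k)) = g k
  f-inj : Injective _≡_ _≡_ f
  f-inj {zero}          {zero}           eq = refl
  f-inj {zero}          {suc zero}       eq = ⊥-elim (u≢v eq)
  f-inj {zero}          {suc (suc k)}    eq = ⊥-elim (u≢g k eq)
  f-inj {suc zero}      {zero}           eq = ⊥-elim (u≢v (sym eq))
  f-inj {suc zero}      {suc zero}       eq = refl
  f-inj {suc zero}      {suc (suc k)}    eq = ⊥-elim (v≢g k eq)
  f-inj {suc (suc k)}   {zero}           eq = ⊥-elim (u≢g k (sym eq))
  f-inj {suc (suc k)}   {suc zero}       eq = ⊥-elim (v≢g k (sym eq))
  f-inj {suc (suc k)}   {suc (suc k′)}   eq = cong (λ k → suc (suc k)) (g-inj eq)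
  f-adj : ∀ i j → adj (Book p) i j ≡ true → adj H (f i) (f j) ≡ true
  f-adj zero          zero          b00 = ⊥-elim (adj⇒≢ (Book p) {zero} b00 refl)
  f-adj zero          (suc zero)    _   = huv
  f-adj zero          (suc (suc k)) _   = hug k
  f-adj (suc zero)    zero          _   = trans (adj-sym H v u) huv
  f-adj (suc zero)    (suc zero)    b11 = ⊥-elim (adj⇒≢ (Book p) {suc zero} b11 refl)
  f-adj (suc zero)    (suc (suc k)) _   = hvg k
  f-adj (suc (suc k)) zero          _   = trans (adj-sym H (g k) u) (hug k)
  f-adj (suc (suc k)) (suc zero)    _   = trans (adj-sym H (g k) v) (hvg k)
  f-adj (suc (suc k)) (suc (suc _)) ()

bookFree⇒spread : ∀ p (H : Graph (p + 4)) → ¬ Contains H (Book p) → Spread (complement H)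
bookFree⇒spread p H book-free u v u≢v ¬kuv with 3 ≤? count (λ w → adj (complement H) u w ∨ adj (complement H) v w)
... | yes 3≤ = 3≤
... | no 3≰  = ⊥-elim (book-free (book-embedding H huv g g-inj u≢g v≢g hug hvg))
  where
  K = complement H
  U : Fin (p + 4) → Bool
  U w = adj K u w ∨ adj K v w
  common : Fin (p + 4) → Bool
  common w = not (u ≟ᵇ w) ∧ not (v ≟ᵇ w) ∧ not (U w)
  ¬common⇒ : ∀ w → not (common w) ≡ true → (((u ≟ᵇ w) ∨ (v ≟ᵇ w)) ∨ U w) ≡ true
  ¬common⇒ w ¬cw with u ≟ᵇ w | v ≟ᵇ w | U w
  ... | true  | _     | _     = refl
  ... | false | true  | _     = refl
  ... | false | false | true  = refl
  ... | false | false | false with () ← ¬cw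
  count-¬common : count (not ∘ common) ≤ 4
  count-¬common = begin
    count (not ∘ common)                              ≤⟨ count-mono _ _ ¬common⇒ ⟩
    count (λ w → ((u ≟ᵇ w) ∨ (v ≟ᵇ w)) ∨ U w)         ≤⟨ count-∨ _ U ⟩
    count (λ w → (u ≟ᵇ w) ∨ (v ≟ᵇ w)) + count U       ≤⟨ +-monoˡ-≤ (count U) (count-∨ (u ≟ᵇ_) (v ≟ᵇ_)) ⟩
    count (u ≟ᵇ_) + count (v ≟ᵇ_) + count U           ≡⟨ cong₂ (λ a b → a + b + count U) (count-≟ᵇ u) (count-≟ᵇ v) ⟩
    2 + count U                                       ≤⟨ +-monoʳ-≤ 2 (≤-pred (≰⇒> 3≰)) ⟩
    4                                                 ∎
    where open ≤-Reasoning
  p≤count-common : p ≤ count common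
  p≤count-common = +-cancelʳ-≤ 4 p (count common)
    (≤-trans (≤-reflexive (sym (count-+-count-not common))) (+-monoʳ-≤ (count common) count-¬common))
  injection = ≤count⇒injection common p≤count-common
  g = proj₁ injection
  g-inj = proj₁ (proj₂ injection)
  facts : ∀ k → not (u ≟ᵇ g k) ≡ true × not (v ≟ᵇ g k) ≡ true × U (g k) ≡ false
  facts k with ∧-≡-true (proj₂ (proj₂ injection) k)
  ... | u≠g , rest with ∧-≡-true rest
  ...   | v≠g , ¬U = u≠g , v≠g , not-≡-true ¬U
  huv = ¬adj-complement⇒adj H u≢v ¬kuv
  u≢g : ∀ k → u ≢ g k
  u≢g k = not-≟ᵇ⇒≢ (proj₁ (facts k))
  v≢g : ∀ k → v ≢ g k
  v≢g k = not-≟ᵇ⇒≢ (proj₁ (proj₂ (facts k)))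
  hug : ∀ k → adj H u (g k) ≡ true
  hug k = ¬adj-complement⇒adj H (u≢g k) (proj₁ (∨-≡-false (proj₂ (proj₂ (facts k)))))
  hvg : ∀ k → adj H v (g k) ≡ true
  hvg k = ¬adj-complement⇒adj H (v≢g k) (proj₂ (∨-≡-false {adj K u (g k)} (proj₂ (proj₂ (facts k)))))

spread⇒bookFree : ∀ p (H : Graph (p + 4)) → Spread (complement H) → ¬ Contains H (Book p)
spread⇒bookFree p H spread (f , f-inj , f-adj) = <⇒≱ (≤-trans (s≤s (s≤s (s≤s z≤n))) 3≤count-U) count-U≤2
  where
  K = complement H
  u = f zero
  v = f (suc zero)
  huv : adj H u v ≡ true
  huv = f-adj zero (suc zero) refl
  U : Fin (p + 4) → Bool
  U w = adj K u w ∨ adj K v w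
  3≤count-U : 3 ≤ count U
  3≤count-U = spread u v (λ eq → case (f-inj eq)) (adj⇒¬adj-complement H huv)
    where
    case : zero ≢ suc zero
    case ()
  ¬U∘f : ∀ i → not (U (f i)) ≡ true
  ¬U∘f zero          rewrite adj-irrefl K u | adj-sym K v u | adj⇒¬adj-complement H huv = refl
  ¬U∘f (suc zero)    rewrite adj-irrefl K v | adj⇒¬adj-complement H huv = refl
  ¬U∘f (suc (suc k)) rewrite adj⇒¬adj-complement H (f-adj zero (suc (suc k)) refl)
                           | adj⇒¬adj-complement H (f-adj (suc zero) (suc (suc k)) refl) = refl
  count-U≤2 : count U ≤ 2
  count-U≤2 = +-cancelʳ-≤ (2 + p) (count U) 2 (begin
    count U + (2 + p)          ≤⟨ +-monoʳ-≤ (count U) (injection⇒≤count (not ∘ U) f f-inj ¬U∘f) ⟩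
    count U + count (not ∘ U)  ≡⟨ count-+-count-not U ⟩
    p + 4                      ≡⟨ +-comm p 4 ⟩
    2 + (2 + p)                ∎)
    where open ≤-Reasoning

-- Degree sums of spread graphs

∑-≥-except : ∀ {m} c (f : Fin (suc m) → ℕ) (z : Fin (suc m)) → (∀ v → v ≢ z → c ≤ f v) → m * c ≤ ∑ f
∑-≥-except {m} c f z c≤f = begin
  m * c                     ≡⟨ ∑-const m c ⟨
  ∑ {m} (λ _ → c)           ≤⟨ ∑-mono-≤ _ _ (λ j → c≤f (punchIn z j) (punchInᵢ≢i z j)) ⟩
  ∑ (f ∘ punchIn z)         ≤⟨ m≤n+m _ (f z) ⟩
  f z + ∑ (f ∘ punchIn z)   ≡⟨ sum-remove f ⟨
  ∑ f                       ∎
  where open ≤-Reasoning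

data MinDegree {n} (K : Graph n) : Set where
  isolated : ∀ z → degree K z ≡ 0 → MinDegree K
  pendant  : ∀ u → degree K u ≡ 1 → (∀ v → degree K v ≢ 0) → MinDegree K
  ≥2       : (∀ v → 2 ≤ degree K v) → MinDegree K

minDegree : ∀ {n} (K : Graph n) → MinDegree K
minDegree K with any? (λ z → degree K z ℕ.≟ 0)
... | yes (z , deg≡0) = isolated z deg≡0
... | no ¬isolated with any? (λ u → degree K u ℕ.≟ 1)
...   | yes (u , deg≡1) = pendant u deg≡1 (λ v deg≡0 → ¬isolated (v , deg≡0))
...   | no ¬pendant = ≥2 (λ v → ≥2-from (degree K v) (λ eq → ¬isolated (v , eq)) (λ eq → ¬pendant (v , eq)))
  where
  ≥2-from : ∀ d → d ≢ 0 → d ≢ 1 → 2 ≤ d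
  ≥2-from zero          d≢0 _   = ⊥-elim (d≢0 refl)
  ≥2-from (suc zero)    _   d≢1 = ⊥-elim (d≢1 refl)
  ≥2-from (suc (suc d)) _   _   = s≤s (s≤s z≤n)

-- Degree sequence of K₂ + (a 2-regular graph).
record ExtremalProfile {n} (K : Graph n) : Set where
  field
    u w          : Fin n
    u≢w          : u ≢ w
    adj-uw       : adj K u w ≡ true
    degree-u     : degree K u ≡ 1
    degree-w     : degree K w ≡ 1
    degree-other : ∀ v → v ≢ u → v ≢ w → degree K v ≡ 2

m+m+2≡1+m+1+m : ∀ m → m + m + 2 ≡ suc m + suc m
m+m+2≡1+m+1+m = solve-∀

module SpreadDegrees {m} (K : Graph (suc m)) (spread : Spread K) where

  isolated⇒ : ∀ z → degree K z ≡ 0 → m + m + m ≤ ∑ (degree K)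
  isolated⇒ z deg≡0 = ≤-trans (≤-reflexive (m+m+m≡m*3 m)) (∑-≥-except 3 (degree K) z 3≤degree)
    where
    m+m+m≡m*3 : ∀ m → m + m + m ≡ m * 3
    m+m+m≡m*3 = solve-∀
    ¬adj-z = count≡0⇒false (adj K z) deg≡0
    3≤degree : ∀ v → v ≢ z → 3 ≤ degree K v
    3≤degree v v≢z = ≤-trans (spread z v (v≢z ∘ sym) (¬adj-z v))
      (≤-reflexive (count-cong _ (adj K v) (λ x → cong (_∨ adj K v x) (¬adj-z x))))

  -- With an extra 1 at u and at w every vertex has weight ≥ 2: w is not isolated, and any other v is not
  -- adjacent to the pendant vertex u, so spreadness gives 1 + degree v ≥ 3.
  module Pendant (u : Fin (suc m)) (deg≡1 : degree K u ≡ 1) (¬isolated : ∀ v → degree K v ≢ 0) where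

    open Σ (count≡1⇒unique (adj K u) deg≡1) renaming (proj₁ to w; proj₂ to w-unique)

    adj-uw : adj K u w ≡ true
    adj-uw = proj₁ w-unique

    u≢w : u ≢ w
    u≢w = adj⇒≢ K adj-uw

    weight : Fin (suc m) → ℕ
    weight v = degree K v + boolToℕ (u ≟ᵇ v) + boolToℕ (w ≟ᵇ v)

    ∑-weight : ∑ weight ≡ ∑ (degree K) + 2
    ∑-weight = begin
      ∑ weight                                                         ≡⟨ ∑-distrib-+ (λ v → degree K v + boolToℕ (u ≟ᵇ v)) (λ v → boolToℕ (w ≟ᵇ v)) ⟩
      ∑ (λ v → degree K v + boolToℕ (u ≟ᵇ v)) + count (w ≟ᵇ_)          ≡⟨ cong (_+ count (w ≟ᵇ_)) (∑-distrib-+ (degree K) (λ v → boolToℕ (u ≟ᵇ v))) ⟩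
      ∑ (degree K) + count (u ≟ᵇ_) + count (w ≟ᵇ_)                     ≡⟨ cong₂ (λ a b → ∑ (degree K) + a + b) (count-≟ᵇ u) (count-≟ᵇ w) ⟩
      ∑ (degree K) + 1 + 1                                             ≡⟨ +-assoc (∑ (degree K)) 1 1 ⟩
      ∑ (degree K) + 2                                                 ∎
      where open ≡-Reasoning

    2≤weight : ∀ v → 2 ≤ weight v
    2≤weight v with u ≟ v | w ≟ v
    ... | yes refl | yes w≡u = ⊥-elim (u≢w (sym w≡u))
    ... | yes refl | no _    = ≤-reflexive (cong (λ d → d + 1 + 0) (sym deg≡1))
    ... | no _     | yes _   = +-monoˡ-≤ 1 (+-monoˡ-≤ 0 (n≢0⇒n>0 (¬isolated v)))
    ... | no u≢v   | no w≢v  = ≤-trans 2≤degree (≤-reflexive (sym (trans (+-identityʳ _) (+-identityʳ _))))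
      where
      ¬adj-uv : adj K u v ≡ false
      ¬adj-uv with adj K u v in kuv
      ... | false = refl
      ... | true  = ⊥-elim (w≢v (sym (proj₂ w-unique v kuv)))
      2≤degree : 2 ≤ degree K v
      2≤degree = ≤-pred (begin
        3                                          ≤⟨ spread u v u≢v ¬adj-uv ⟩
        count (λ x → adj K u x ∨ adj K v x)        ≤⟨ count-∨ (adj K u) (adj K v) ⟩
        degree K u + degree K v                    ≡⟨ cong (_+ degree K v) deg≡1 ⟩
        1 + degree K v                             ∎)
        where open ≤-Reasoning

    2m≤∑ : m + m ≤ ∑ (degree K)
    2m≤∑ = +-cancelʳ-≤ 2 (m + m) (∑ (degree K)) (begin
      m + m + 2                ≡⟨ m+m+2≡1+m+1+m m ⟩
      suc m + suc m            ≡⟨ ∑-double (suc m) ⟨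
      ∑ {suc m} (λ _ → 2)      ≤⟨ ∑-mono-≤ _ weight 2≤weight ⟩
      ∑ weight                 ≡⟨ ∑-weight ⟩
      ∑ (degree K) + 2         ∎)
      where open ≤-Reasoning

    weight≡2 : ∑ (degree K) ≡ m + m → ∀ v → 2 ≡ weight v
    weight≡2 ∑≡2m = ∑-tight (λ _ → 2) weight 2≤weight (begin
      ∑ weight              ≡⟨ ∑-weight ⟩
      ∑ (degree K) + 2      ≡⟨ cong (_+ 2) ∑≡2m ⟩
      m + m + 2             ≡⟨ m+m+2≡1+m+1+m m ⟩
      suc m + suc m         ≡⟨ ∑-double (suc m) ⟨
      ∑ {suc m} (λ _ → 2)   ∎)
      where open ≤-Reasoning

    extremal : ∑ (degree K) ≡ m + m → ExtremalProfile K
    extremal ∑≡2m = record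
      { u = u ; w = w ; u≢w = u≢w ; adj-uw = adj-uw ; degree-u = deg≡1
      ; degree-w = degree-w ; degree-other = degree-other }
      where
      degree-w : degree K w ≡ 1
      degree-w = +-cancelʳ-≡ 1 (degree K w) 1 (sym (begin
        2                                                        ≡⟨ weight≡2 ∑≡2m w ⟩
        degree K w + boolToℕ (u ≟ᵇ w) + boolToℕ (w ≟ᵇ w)         ≡⟨ cong₂ (λ a b → degree K w + boolToℕ a + boolToℕ b) (≟ᵇ-≢ u≢w) (≟ᵇ-refl w) ⟩
        degree K w + 0 + 1                                       ≡⟨ cong (_+ 1) (+-identityʳ (degree K w)) ⟩
        degree K w + 1                                           ∎))
        where open ≡-Reasoning
      degree-other : ∀ v → v ≢ u → v ≢ w → degree K v ≡ 2
      degree-other v v≢u v≢w = sym (begin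
        2                                                        ≡⟨ weight≡2 ∑≡2m v ⟩
        degree K v + boolToℕ (u ≟ᵇ v) + boolToℕ (w ≟ᵇ v)         ≡⟨ cong₂ (λ a b → degree K v + boolToℕ a + boolToℕ b) (≟ᵇ-≢ (v≢u ∘ sym)) (≟ᵇ-≢ (v≢w ∘ sym)) ⟩
        degree K v + 0 + 0                                       ≡⟨ trans (+-identityʳ _) (+-identityʳ _) ⟩
        degree K v                                               ∎)
        where open ≡-Reasoning

  ≥2⇒ : (∀ v → 2 ≤ degree K v) → suc m + suc m ≤ ∑ (degree K)
  ≥2⇒ 2≤degree = ≤-trans (≤-reflexive (sym (∑-double (suc m)))) (∑-mono-≤ _ _ 2≤degree)

  2m≤∑degree : m + m ≤ ∑ (degree K)
  2m≤∑degree with minDegree K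
  ... | isolated z deg≡0         = ≤-trans (m≤m+n (m + m) m) (isolated⇒ z deg≡0)
  ... | pendant u deg≡1 ¬isolated = Pendant.2m≤∑ u deg≡1 ¬isolated
  ... | ≥2 2≤degree               = ≤-trans (+-mono-≤ (n≤1+n m) (n≤1+n m)) (≥2⇒ 2≤degree)

  ∑degree≡2m⇒extremal : 1 ≤ m → ∑ (degree K) ≡ m + m → ExtremalProfile K
  ∑degree≡2m⇒extremal 1≤m ∑≡2m with minDegree K
  ... | isolated z deg≡0 = ⊥-elim (<⇒≱ 1≤m (+-cancelˡ-≤ (m + m) m 0
          (≤-trans (isolated⇒ z deg≡0) (≤-reflexive (trans ∑≡2m (sym (+-identityʳ (m + m))))))))
  ... | pendant u deg≡1 ¬isolated = Pendant.extremal u deg≡1 ¬isolated ∑≡2m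
  ... | ≥2 2≤degree = ⊥-elim (<⇒≱ (+-mono-< (n<1+n m) (n<1+n m)) (≤-trans (≥2⇒ 2≤degree) (≤-reflexive ∑≡2m)))

data SplitView (m k : ℕ) : Fin (m + k) → Set where
  left  : (a : Fin m) → SplitView m k (a ↑ˡ k)
  right : (b : Fin k) → SplitView m k (m ↑ʳ b)

splitView : ∀ m k (i : Fin (m + k)) → SplitView m k i
splitView m k i with splitAt m i in eq
... | inj₁ a = subst (SplitView m k) (splitAt⁻¹-↑ˡ eq) (left a)
... | inj₂ b = subst (SplitView m k) (splitAt⁻¹-↑ʳ eq) (right b)

↑ˡ≢↑ʳ : ∀ {m k} (a : Fin m) (b : Fin k) → a ↑ˡ k ≢ m ↑ʳ b
↑ˡ≢↑ʳ {m} {k} a b eq with () ← trans (sym (splitAt-↑ˡ m a k)) (trans (cong (splitAt m) eq) (splitAt-↑ʳ m k b))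

module _ {m k : ℕ} (G : Graph m) (G′ : Graph k) where

  adj-⊕-↑ˡ-↑ˡ : ∀ a b → adj (G ⊕ G′) (a ↑ˡ k) (b ↑ˡ k) ≡ adj G a b
  adj-⊕-↑ˡ-↑ˡ a b rewrite splitAt-↑ˡ m a k | splitAt-↑ˡ m b k | adj-sym G b a with adj G a b in gab
  ... | false = refl
  ... | true rewrite ≟ᵇ-≢ {i = a ↑ˡ k} {j = b ↑ˡ k} (adj⇒≢ G gab ∘ ↑ˡ-injective k a b) = refl

  adj-⊕-↑ʳ-↑ʳ : ∀ a b → adj (G ⊕ G′) (m ↑ʳ a) (m ↑ʳ b) ≡ adj G′ a b
  adj-⊕-↑ʳ-↑ʳ a b rewrite splitAt-↑ʳ m k a | splitAt-↑ʳ m k b | adj-sym G′ b a with adj G′ a b in gab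
  ... | false = refl
  ... | true rewrite ≟ᵇ-≢ {i = m ↑ʳ a} {j = m ↑ʳ b} (adj⇒≢ G′ gab ∘ ↑ʳ-injective m a b) = refl

  adj-⊕-↑ˡ-↑ʳ : ∀ a b → adj (G ⊕ G′) (a ↑ˡ k) (m ↑ʳ b) ≡ false
  adj-⊕-↑ˡ-↑ʳ a b rewrite splitAt-↑ˡ m a k | splitAt-↑ʳ m k b = refl

  adj-⊕-↑ʳ-↑ˡ : ∀ a b → adj (G ⊕ G′) (m ↑ʳ b) (a ↑ˡ k) ≡ false
  adj-⊕-↑ʳ-↑ˡ a b rewrite splitAt-↑ˡ m a k | splitAt-↑ʳ m k b = refl

  degree-⊕-↑ˡ : ∀ a → degree (G ⊕ G′) (a ↑ˡ k) ≡ degree G a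
  degree-⊕-↑ˡ a = trans (∑-splitAt m k _)
    (trans (cong₂ _+_ (count-cong _ _ (adj-⊕-↑ˡ-↑ˡ a)) (count-false _ (adj-⊕-↑ˡ-↑ʳ a))) (+-identityʳ _))

  degree-⊕-↑ʳ : ∀ b → degree (G ⊕ G′) (m ↑ʳ b) ≡ degree G′ b
  degree-⊕-↑ʳ b = trans (∑-splitAt m k _)
    (cong₂ _+_ (count-false _ (λ a → adj-⊕-↑ʳ-↑ˡ a b)) (count-cong _ _ (adj-⊕-↑ʳ-↑ʳ b)))

  ∑degree-⊕ : ∑ (degree (G ⊕ G′)) ≡ ∑ (degree G) + ∑ (degree G′)
  ∑degree-⊕ = trans (∑-splitAt m k _) (cong₂ _+_ (∑-cong degree-⊕-↑ˡ) (∑-cong degree-⊕-↑ʳ))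

-- Cycles

-- The cycle on suc t vertices, as the successor map k ↦ k + 1 mod (suc t).
module CycleMaps (t : ℕ) where

  s = suc t

  open import Function.Endo.Propositional (Fin s) using (_^_)

  next : Fin s → Fin s
  next a with suc (toℕ a) <? s
  ... | yes a+1<s = fromℕ< a+1<s
  ... | no _      = zero

  data NextSpec (a : Fin s) (b : Fin s) : Set where
    step : suc (toℕ a) ≡ toℕ b → suc (toℕ a) < s → NextSpec a b
    wrap : toℕ b ≡ 0 → suc (toℕ a) ≡ s → NextSpec a b

  next-spec : ∀ a → NextSpec a (next a)
  next-spec a with suc (toℕ a) <? s
  ... | yes a+1<s = step (sym (toℕ-fromℕ< a+1<s)) a+1<s
  ... | no a+1≮s  = wrap refl (≤-antisym (toℕ<n a) (≮⇒≥ a+1≮s))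

  prev : Fin s → Fin s
  prev zero    = fromℕ t
  prev (suc a) = inject₁ a

  next-prev : ∀ a → next (prev a) ≡ a
  next-prev zero with next-spec (fromℕ t)
  ... | step _ lt  = ⊥-elim (<-irrefl (cong suc (toℕ-fromℕ t)) lt)
  ... | wrap eq _  = toℕ-injective eq
  next-prev (suc a) with next-spec (inject₁ a)
  ... | step eq _  = toℕ-injective (trans (sym eq) (cong suc (toℕ-inject₁ a)))
  ... | wrap _ eq  = ⊥-elim (<-irrefl (trans (sym (toℕ-inject₁ a)) (ℕ.suc-injective eq)) (toℕ<n a))

  next-injective : ∀ {a b} → next a ≡ next b → a ≡ b
  next-injective {a} {b} eq with next-spec a | next-spec b
  ... | step ea _ | step eb _ = toℕ-injective (ℕ.suc-injective (trans ea (trans (cong toℕ eq) (sym eb))))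
  ... | step ea _ | wrap eb _ = ⊥-elim (0≢1+n (sym (trans ea (trans (cong toℕ eq) eb))))
  ... | wrap ea _ | step eb _ = ⊥-elim (0≢1+n (sym (trans eb (trans (cong toℕ (sym eq)) ea))))
  ... | wrap _ ea | wrap _ eb = toℕ-injective (ℕ.suc-injective (trans ea (sym eb)))

  prev-next : ∀ a → prev (next a) ≡ a
  prev-next a = next-injective (next-prev (next a))

  prev-injective : ∀ {a b} → prev a ≡ prev b → a ≡ b
  prev-injective {a} {b} eq = trans (sym (next-prev a)) (trans (cong next eq) (next-prev b))

  toℕ-next^ : ∀ a k → Σ ℕ λ c → toℕ a + k ≡ toℕ ((next ^ k) a) + s * c
  toℕ-next^ a zero = 0 , trans (+-identityʳ _) (sym (trans (cong (toℕ a +_) (*-zeroʳ s)) (+-identityʳ _)))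
  toℕ-next^ a (suc k) with toℕ-next^ a k
  ... | c , eq with next-spec ((next ^ k) a)
  ...   | step e _   = c , trans (+-suc (toℕ a) k) (trans (cong suc eq) (cong (_+ s * c) e))
  ...   | wrap e1 e2 = suc c , trans (+-suc (toℕ a) k) (trans (cong suc eq)
          (trans (cong (_+ s * c) e2) (sym (trans (cong (_+ s * suc c) e1) (*-suc s c)))))

  next^-≢ : ∀ a k → 0 < k → k < s → (next ^ k) a ≢ a
  next^-≢ a k 0<k k<s eq with toℕ-next^ a k
  ... | c , e = not-multiple c (+-cancelˡ-≡ (toℕ a) k (s * c) (trans e (cong (_+ s * c) (cong toℕ eq))))
    where
    not-multiple : ∀ c → k ≢ s * c
    not-multiple zero    k≡0   = <-irrefl (sym (trans k≡0 (*-zeroʳ s))) 0<k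
    not-multiple (suc c) k≡s*c = <⇒≱ k<s (≤-trans (m≤m+n s (s * c)) (≤-reflexive (trans (sym (*-suc s c)) (sym k≡s*c))))

  next≢id : 1 ≤ t → ∀ a → next a ≢ a
  next≢id 1≤t a = next^-≢ a 1 (s≤s z≤n) (s≤s 1≤t)

  next≢prev : 2 ≤ t → ∀ a → next a ≢ prev a
  next≢prev 2≤t a eq = next^-≢ a 2 (s≤s z≤n) (s≤s 2≤t) (trans (cong next eq) (next-prev a))

  successor : Fin s → Fin s → Bool
  successor a b = (suc (toℕ a) ≡ᵇ toℕ b) ∨ ((toℕ a ≡ᵇ 0) ∧ (suc (toℕ b) ≡ᵇ s))

  successor⇒ : ∀ a b → successor a b ≡ true → b ≡ next a ⊎ a ≡ next b
  successor⇒ a b sab with (suc (toℕ a) ≡ᵇ toℕ b) in e1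
  ... | true with next-spec a
  ...   | step e2 _ = inj₁ (toℕ-injective (trans (sym (≡ᵇ-true⇒≡ e1)) e2))
  ...   | wrap _ e2 = ⊥-elim (<-irrefl (trans (sym (≡ᵇ-true⇒≡ e1)) e2) (toℕ<n b))
  successor⇒ a b sab | false with (toℕ a ≡ᵇ 0) in e3 | (suc (toℕ b) ≡ᵇ s) in e4
  ... | true | true with next-spec b
  ...   | step _ lt = ⊥-elim (<-irrefl (≡ᵇ-true⇒≡ e4) lt)
  ...   | wrap e5 _ = inj₂ (toℕ-injective (trans (≡ᵇ-true⇒≡ e3) (sym e5)))
  successor⇒ a b () | false | true  | false
  successor⇒ a b () | false | false | _

  next⇒successor : ∀ a → successor a (next a) ≡ true ⊎ successor (next a) a ≡ true
  next⇒successor a with next-spec a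
  ... | step e _   = inj₁ (∨-≡-trueˡ ((toℕ a ≡ᵇ 0) ∧ (suc (toℕ (next a)) ≡ᵇ s)) (≡⇒≡ᵇ-true e))
  ... | wrap e1 e2 = inj₂ (∨-≡-trueʳ _ (cong₂ _∧_ (≡⇒≡ᵇ-true e1) (≡⇒≡ᵇ-true e2)))

  adj-cycle⇒ : ∀ a b → adj (Cycle s) a b ≡ true → b ≡ next a ⊎ b ≡ prev a
  adj-cycle⇒ a b cab with ∨-≡-true {successor a b} (proj₁ (∧-≡-true cab))
  ... | inj₁ sab = Data.Sum.map₂ a≡next⇒b≡prev (successor⇒ a b sab)
    where
    a≡next⇒b≡prev : a ≡ next b → b ≡ prev a
    a≡next⇒b≡prev eq = trans (sym (prev-next b)) (cong prev (sym eq))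
  ... | inj₂ sba with successor⇒ b a sba
  ...   | inj₁ a≡next-b = inj₂ (trans (sym (prev-next b)) (cong prev (sym a≡next-b)))
  ...   | inj₂ b≡next-a = inj₁ b≡next-a

  adj-next : 1 ≤ t → ∀ a → adj (Cycle s) a (next a) ≡ true
  adj-next 1≤t a = cong₂ _∧_ (either (next⇒successor a)) (cong not (≟ᵇ-≢ (next≢id 1≤t a ∘ sym)))
    where
    either : successor a (next a) ≡ true ⊎ successor (next a) a ≡ true →
             (successor a (next a) ∨ successor (next a) a) ≡ true
    either (inj₁ sa) = ∨-≡-trueˡ (successor (next a) a) sa
    either (inj₂ sb) = ∨-≡-trueʳ (successor a (next a)) sb

  adj-prev : 1 ≤ t → ∀ a → adj (Cycle s) a (prev a) ≡ true
  adj-prev 1≤t a = trans (adj-sym (Cycle s) a (prev a))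
    (subst (λ x → adj (Cycle s) (prev a) x ≡ true) (next-prev a) (adj-next 1≤t (prev a)))

  cycle-neighbours : 2 ≤ t → ∀ a → ExactlyTwo (adj (Cycle s) a)
  cycle-neighbours 2≤t a = record
    { x = next a ; y = prev a ; x≢y = next≢prev 2≤t a
    ; fx = adj-next 1≤t a ; fy = adj-prev 1≤t a ; only = adj-cycle⇒ a }
    where
    1≤t = ≤-trans (s≤s z≤n) 2≤t

degree-Cycle : ∀ t → 2 ≤ t → ∀ a → degree (Cycle (suc t)) a ≡ 2
degree-Cycle t 2≤t a = exactlyTwo⇒count≡2 (CycleMaps.cycle-neighbours t 2≤t a)

degree-K2 : ∀ a → degree K2 a ≡ 1
degree-K2 a = +-cancelʳ-≡ 1 (degree K2 a) 1 (count-≢ a)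

degree-cycles : ∀ l → All (3 ≤_) l → ∀ x → degree (cycles l) x ≡ 2
degree-cycles (s ∷ l) (s≤s (s≤s (s≤s {n = t}  _)) ∷ 3≤l) x with splitView s (sum l) x
... | left a  = trans (degree-⊕-↑ˡ (Cycle s) (cycles l) a) (degree-Cycle (suc (suc t)) (s≤s (s≤s z≤n)) a)
... | right b = trans (degree-⊕-↑ʳ (Cycle s) (cycles l) b) (degree-cycles l 3≤l b)

∑degree-K2⊕ : ∀ {k} (G : Graph k) → (∀ x → degree G x ≡ 2) → ∑ (degree (K2 ⊕ G)) ≡ 2 + (k + k)
∑degree-K2⊕ {k} G 2-regular = begin
  ∑ (degree (K2 ⊕ G))                ≡⟨ ∑degree-⊕ K2 G ⟩
  ∑ (degree K2) + ∑ (degree G)       ≡⟨ cong₂ _+_ (∑-cong degree-K2) (trans (∑-cong 2-regular) (∑-double k)) ⟩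
  2 + (k + k)                        ∎
  where open ≡-Reasoning

other : Fin 2 → Fin 2
other zero       = suc zero
other (suc zero) = zero

adj-K2-other : ∀ a → adj K2 a (other a) ≡ true
adj-K2-other zero       = refl
adj-K2-other (suc zero) = refl

-- Non-adjacent vertices of K₂ + C_s see at least three vertices; for two vertices of the cycle at
-- distance 2 this needs s ≠ 4.
module K2⊕CycleSpread (t : ℕ) (4≤t : 4 ≤ t) where

  open CycleMaps t
  open ≡-Reasoning
  M = K2 ⊕ Cycle s
  1≤t = ≤-trans (s≤s z≤n) 4≤t
  N : Fin (2 + s) → Fin (2 + s) → Fin (2 + s) → Bool
  N x y z = adj M x z ∨ adj M y z
  L : Fin 2 → Fin (2 + s)
  L a = a ↑ˡ s
  R : Fin s → Fin (2 + s)
  R b = 2 ↑ʳ b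
  R-injective : ∀ {a b} → R a ≡ R b → a ≡ b
  R-injective = ↑ʳ-injective 2 _ _
  next≢prev-R : ∀ b → R (next b) ≢ R (prev b)
  next≢prev-R b = next≢prev (≤-trans (s≤s (s≤s z≤n)) 4≤t) b ∘ R-injective
  adj-L : ∀ a → adj M (L a) (L (other a)) ≡ true
  adj-L a = trans (adj-⊕-↑ˡ-↑ˡ K2 (Cycle s) a (other a)) (adj-K2-other a)
  adj-R-next : ∀ b → adj M (R b) (R (next b)) ≡ true
  adj-R-next b = trans (adj-⊕-↑ʳ-↑ʳ K2 (Cycle s) b (next b)) (adj-next 1≤t b)
  adj-R-prev : ∀ b → adj M (R b) (R (prev b)) ≡ true
  adj-R-prev b = trans (adj-⊕-↑ʳ-↑ʳ K2 (Cycle s) b (prev b)) (adj-prev 1≤t b)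

  spread : Spread (K2 ⊕ Cycle s)
  spread u v u≢v ¬adj-uv with splitView 2 s u | splitView 2 s v
  ... | left a  | left b  with () ← trans (sym ¬adj-uv)
          (trans (adj-⊕-↑ˡ-↑ˡ K2 (Cycle s) a b) (cong not (≟ᵇ-≢ (u≢v ∘ cong (_↑ˡ s)))))
  ... | left a  | right b = three⇒3≤count (N (L a) (R b)) (L (other a)) (R (next b)) (R (prev b))
          (↑ˡ≢↑ʳ _ _) (↑ˡ≢↑ʳ _ _) (next≢prev-R b)
          (∨-≡-trueˡ _ (adj-L a)) (∨-≡-trueʳ _ (adj-R-next b)) (∨-≡-trueʳ _ (adj-R-prev b))
  ... | right a | left b  = three⇒3≤count (N (R a) (L b)) (L (other b)) (R (next a)) (R (prev a))
          (↑ˡ≢↑ʳ _ _) (↑ˡ≢↑ʳ _ _) (next≢prev-R a)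
          (∨-≡-trueʳ _ (adj-L b)) (∨-≡-trueˡ _ (adj-R-next a)) (∨-≡-trueˡ _ (adj-R-prev a))
  ... | right a | right b with next b ≟ next a | next b ≟ prev a | prev b ≟ next a | prev b ≟ prev a
  ...   | yes eq | _ | _ | _ = ⊥-elim (u≢v (cong R (next-injective (sym eq))))
  ...   | _ | _ | _ | yes eq = ⊥-elim (u≢v (cong R (prev-injective (sym eq))))
  ...   | no _ | yes next-b≡prev-a | yes prev-b≡next-a | no _ =
          ⊥-elim (next^-≢ a 4 (s≤s z≤n) (s≤s 4≤t) (begin
            next (next (next (next a)))   ≡⟨ cong (next ∘ next ∘ next) prev-b≡next-a ⟨
            next (next (next (prev b)))   ≡⟨ cong (next ∘ next) (next-prev b) ⟩
            next (next b)                 ≡⟨ cong next next-b≡prev-a ⟩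
            next (prev a)                 ≡⟨ next-prev a ⟩
            a                             ∎))
  ...   | no next-b≢next-a | no next-b≢prev-a | _ | _ =
          three⇒3≤count (N (R a) (R b)) (R (next a)) (R (prev a)) (R (next b)) (next≢prev-R a)
          (next-b≢next-a ∘ R-injective ∘ sym) (next-b≢prev-a ∘ R-injective ∘ sym)
          (∨-≡-trueˡ _ (adj-R-next a)) (∨-≡-trueˡ _ (adj-R-prev a)) (∨-≡-trueʳ _ (adj-R-next b))
  ...   | no _ | _ | no prev-b≢next-a | no prev-b≢prev-a =
          three⇒3≤count (N (R a) (R b)) (R (next a)) (R (prev a)) (R (prev b)) (next≢prev-R a)
          (prev-b≢next-a ∘ R-injective ∘ sym) (prev-b≢prev-a ∘ R-injective ∘ sym)
          (∨-≡-trueˡ _ (adj-R-next a)) (∨-≡-trueˡ _ (adj-R-prev a)) (∨-≡-trueʳ _ (adj-R-prev b))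

-- Decomposing 2-regular graphs into cycles

record ComponentEmbedding {k m} (X : Graph k) (G : Graph m) : Set where
  field
    embed     : Fin k → Fin m
    injective : Injective _≡_ _≡_ embed
    adj-embed : ∀ a b → adj G (embed a) (embed b) ≡ adj X a b
    closed    : ∀ a y → adj G (embed a) y ≡ true → Σ (Fin k) λ b → embed b ≡ y

CycleIn : ∀ {m} → Graph m → Set
CycleIn G = Σ ℕ λ t → 2 ≤ t × ComponentEmbedding (Cycle (suc t)) G

module Walk {m} (G : Graph m) (neighbours : ∀ x → ExactlyTwo (adj G x)) where

  record Path (t : ℕ) : Set where
    field
      vertex    : ℕ → Fin m
      injective : ∀ i j → i < t → j < t → vertex i ≡ vertex j → i ≡ j
      adjacent  : ∀ i → suc i < t → adj G (vertex i) (vertex (suc i)) ≡ true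

  open Path

  close : ∀ t → 1 ≤ t → (P : Path (2 + t)) → adj G (vertex P (suc t)) (vertex P 0) ≡ true → CycleIn G
  close t 1≤t P last~first = suc t , s≤s 1≤t , record
    { embed = g ; injective = g-injective ; adj-embed = adj-g ; closed = closed }
    where
    open CycleMaps (suc t)
    g : Fin s → Fin m
    g a = vertex P (toℕ a)
    g-injective : Injective _≡_ _≡_ g
    g-injective {a} {b} eq = toℕ-injective (injective P (toℕ a) (toℕ b) (toℕ<n a) (toℕ<n b) eq)
    g-next : ∀ a → adj G (g a) (g (next a)) ≡ true
    g-next a with next-spec a
    ... | step e a+1<s = subst (λ k → adj G (g a) (vertex P k) ≡ true) e (adjacent P (toℕ a) a+1<s)
    ... | wrap e1 e2   = subst₂ (λ k k′ → adj G (vertex P k) (vertex P k′) ≡ true)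
                                (sym (ℕ.suc-injective e2)) (sym e1) last~first
    g-prev : ∀ a → adj G (g a) (g (prev a)) ≡ true
    g-prev a = trans (adj-sym G (g a) (g (prev a)))
      (subst (λ x → adj G (g (prev a)) (g x) ≡ true) (next-prev a) (g-next (prev a)))
    g-neighbours : ∀ a y → adj G (g a) y ≡ true → y ≡ g (next a) ⊎ y ≡ g (prev a)
    g-neighbours a = exactlyTwo-only (neighbours (g a)) (g-next a) (g-prev a)
                       (next≢prev (s≤s 1≤t) a ∘ g-injective)
    closed : ∀ a y → adj G (g a) y ≡ true → Σ (Fin s) λ b → g b ≡ y
    closed a y gay with g-neighbours a y gay
    ... | inj₁ y≡next = next a , sym y≡next
    ... | inj₂ y≡prev = prev a , sym y≡prev
    adj-g : ∀ a b → adj G (g a) (g b) ≡ adj (Cycle s) a b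
    adj-g a b = bool-ext to from
      where
      to : adj G (g a) (g b) ≡ true → adj (Cycle s) a b ≡ true
      to gab with g-neighbours a (g b) gab
      ... | inj₁ eq = subst (λ x → adj (Cycle s) a x ≡ true) (sym (g-injective eq)) (adj-next (s≤s z≤n) a)
      ... | inj₂ eq = subst (λ x → adj (Cycle s) a x ≡ true) (sym (g-injective eq)) (adj-prev (s≤s z≤n) a)
      from : adj (Cycle s) a b ≡ true → adj G (g a) (g b) ≡ true
      from cab with adj-cycle⇒ a b cab
      ... | inj₁ refl = g-next a
      ... | inj₂ refl = g-prev a

  -- A 2-regular walk can only re-enter itself at its starting vertex.
  re-entry⇒start : ∀ {t} (P : Path (2 + t)) {y} → adj G (vertex P (suc t)) y ≡ true → y ≢ vertex P t →
    ∀ i → i < 2 + t → vertex P i ≡ y → i ≡ 0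
  re-entry⇒start P last~y y≢prev zero _ _ = refl
  re-entry⇒start {t} P {y} last~y y≢prev (suc j) (s≤s j<1+t) Pj+1≡y with m<1+n⇒m<n∨m≡n j<1+t
  ... | inj₂ refl with () ← trans (sym (adj-irrefl G y)) (subst (λ x → adj G x y ≡ true) Pj+1≡y last~y)
  ... | inj₁ j<t with m<1+n⇒m<n∨m≡n (s≤s j<t)
  ...   | inj₂ refl = ⊥-elim (y≢prev (sym Pj+1≡y))
  ...   | inj₁ j+1<t with exactlyTwo-only (neighbours (vertex P (suc j))) j+1~j j+1~j+2 j≢j+2
                          (vertex P (suc t)) (subst (λ x → adj G x _ ≡ true) (sym Pj+1≡y) y~last)
    where
    j+2<2+t : suc (suc j) < 2 + t
    j+2<2+t = s≤s (s≤s (<⇒≤ j+1<t))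
    j<2+t : j < 2 + t
    j<2+t = <-trans (n<1+n j) (<-trans (n<1+n (suc j)) j+2<2+t)
    y~last : adj G y (vertex P (suc t)) ≡ true
    y~last = trans (adj-sym G y _) last~y
    j+1~j : adj G (vertex P (suc j)) (vertex P j) ≡ true
    j+1~j = trans (adj-sym G _ _) (adjacent P j (<-trans (n<1+n (suc j)) j+2<2+t))
    j+1~j+2 : adj G (vertex P (suc j)) (vertex P (suc (suc j))) ≡ true
    j+1~j+2 = adjacent P (suc j) j+2<2+t
    j≢j+2 : vertex P j ≢ vertex P (suc (suc j))
    j≢j+2 eq with () ← injective P j (suc (suc j)) j<2+t j+2<2+t eq
  ...     | inj₁ last≡j = ⊥-elim (<-irrefl (sym t+1≡j) (<-trans (<-trans (n<1+n j) j+1<t) (n<1+n t)))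
    where
    t+1≡j : suc t ≡ j
    t+1≡j = injective P (suc t) j (n<1+n (suc t)) (<-trans (n<1+n j) (<-trans (n<1+n (suc j)) (s≤s (s≤s (<⇒≤ j+1<t))))) last≡j
  ...     | inj₂ last≡j+2 = ⊥-elim (<-irrefl (sym (ℕ.suc-injective t+1≡j+2)) j+1<t)
    where
    t+1≡j+2 : suc t ≡ suc (suc j)
    t+1≡j+2 = injective P (suc t) (suc (suc j)) (n<1+n (suc t)) (s≤s (s≤s (<⇒≤ j+1<t))) last≡j+2

  setAt : (ℕ → Fin m) → ℕ → Fin m → ℕ → Fin m
  setAt f t y k with k ℕ.≟ t
  ... | yes _ = y
  ... | no _  = f k

  setAt-< : ∀ f t y k → k < t → setAt f t y k ≡ f k
  setAt-< f t y k k<t with k ℕ.≟ t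
  ... | yes k≡t = ⊥-elim (<-irrefl k≡t k<t)
  ... | no _    = refl

  setAt-≡ : ∀ f t y → setAt f t y t ≡ y
  setAt-≡ f t y with t ℕ.≟ t
  ... | yes _   = refl
  ... | no t≢t  = ⊥-elim (t≢t refl)

  extend : ∀ {t} (P : Path (suc t)) y → (∀ k → k < suc t → vertex P k ≢ y) →
    adj G (vertex P t) y ≡ true → Path (2 + t)
  extend {t} P y fresh last~y = record { vertex = f′ ; injective = injective′ ; adjacent = adjacent′ }
    where
    f′ = setAt (vertex P) (suc t) y
    injective′ : ∀ i j → i < 2 + t → j < 2 + t → f′ i ≡ f′ j → i ≡ j
    injective′ i j i< j< eq with m<1+n⇒m<n∨m≡n i< | m<1+n⇒m<n∨m≡n j<
    ... | inj₁ i<1+t | inj₁ j<1+t = injective P i j i<1+t j<1+t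
            (trans (sym (setAt-< (vertex P) (suc t) y i i<1+t)) (trans eq (setAt-< (vertex P) (suc t) y j j<1+t)))
    ... | inj₂ refl  | inj₂ refl  = refl
    ... | inj₁ i<1+t | inj₂ refl  = ⊥-elim (fresh i i<1+t (trans (sym (setAt-< (vertex P) (suc t) y i i<1+t)) (trans eq (setAt-≡ (vertex P) (suc t) y))))
    ... | inj₂ refl  | inj₁ j<1+t = ⊥-elim (fresh j j<1+t (trans (sym (setAt-< (vertex P) (suc t) y j j<1+t)) (trans (sym eq) (setAt-≡ (vertex P) (suc t) y))))
    adjacent′ : ∀ i → suc i < 2 + t → adj G (f′ i) (f′ (suc i)) ≡ true
    adjacent′ i i+1< with m<1+n⇒m<n∨m≡n i+1<
    ... | inj₁ i+1<1+t = subst₂ (λ a b → adj G a b ≡ true) (sym (setAt-< (vertex P) (suc t) y i (<-trans (n<1+n i) i+1<1+t)))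
                           (sym (setAt-< (vertex P) (suc t) y (suc i) i+1<1+t)) (adjacent P i i+1<1+t)
    ... | inj₂ refl    = subst₂ (λ a b → adj G a b ≡ true) (sym (setAt-< (vertex P) (suc t) y t (n<1+n t))) (sym (setAt-≡ (vertex P) (suc t) y)) last~y

  -- fuel bounds the number of vertices not yet on the path.
  walk : ∀ fuel t → 2 + t + fuel ≡ suc m → Path (2 + t) → CycleIn G
  walk zero t 2+t≡1+m P = ⊥-elim (<-irrefl refl (≤-trans (≤-reflexive (sym (trans (sym (+-identityʳ _)) 2+t≡1+m)))
                                                         (injective⇒≤ {f = g} g-injective)))
    where
    g : Fin (2 + t) → Fin m
    g i = vertex P (toℕ i)
    g-injective : Injective _≡_ _≡_ g
    g-injective {a} {b} eq = toℕ-injective (injective P (toℕ a) (toℕ b) (toℕ<n a) (toℕ<n b) eq)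
  walk (suc fuel) t eq P with exactlyTwo-other (neighbours (vertex P (suc t)))
                                (trans (adj-sym G _ _) (adjacent P t (n<1+n (suc t))))
  ... | y , last~y , y≢prev with any? (λ (i : Fin (2 + t)) → vertex P (toℕ i) ≟ y)
  ...   | yes (i , Pi≡y) = close t 1≤t P (subst (λ x → adj G _ x ≡ true) (sym P0≡y) last~y)
    where
    i≡0 : toℕ i ≡ 0
    i≡0 = re-entry⇒start P last~y y≢prev (toℕ i) (toℕ<n i) Pi≡y
    P0≡y : vertex P 0 ≡ y
    P0≡y = trans (cong (vertex P) (sym i≡0)) Pi≡y
    1≤t : 1 ≤ t
    1≤t = n≢0⇒n>0 λ { refl → y≢prev (sym P0≡y) }
  ...   | no y-fresh = walk fuel (suc t) (trans (sym (+-suc (2 + t) fuel)) eq)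
                         (extend P y fresh last~y)
    where
    fresh : ∀ k → k < 2 + t → vertex P k ≢ y
    fresh k k< Pk≡y = y-fresh (fromℕ< k< , subst (λ x → vertex P x ≡ y) (sym (toℕ-fromℕ< k<)) Pk≡y)

  start : ∀ {m′} → m ≡ suc m′ → CycleIn G
  start {m′} refl = walk m′ 0 refl (record { vertex = f ; injective = f-injective ; adjacent = f-adjacent })
    where
    a = ExactlyTwo.x (neighbours zero)
    0~a : adj G zero a ≡ true
    0~a = ExactlyTwo.fx (neighbours zero)
    f : ℕ → Fin m
    f (suc zero) = a
    f _          = zero
    0≢a : zero ≢ a
    0≢a = adj⇒≢ G 0~a
    f-injective : ∀ i j → i < 2 → j < 2 → f i ≡ f j → i ≡ j
    f-injective zero       zero       _ _ _  = refl
    f-injective zero       (suc zero) _ _ eq = ⊥-elim (0≢a eq)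
    f-injective (suc zero) zero       _ _ eq = ⊥-elim (0≢a (sym eq))
    f-injective (suc zero) (suc zero) _ _ _  = refl
    f-injective (suc (suc i)) _ (s≤s (s≤s ())) _ _
    f-injective _ (suc (suc j)) _ (s≤s (s≤s ())) _
    f-adjacent : ∀ i → suc i < 2 → adj G (f i) (f (suc i)) ≡ true
    f-adjacent zero    _ = 0~a
    f-adjacent (suc i) (s≤s (s≤s ()))

record GraphBijection {k m} (X : Graph k) (G : Graph m) : Set where
  field
    to         : Fin k → Fin m
    injective  : Injective _≡_ _≡_ to
    surjective : ∀ y → Σ (Fin k) λ a → to a ≡ y
    adj-to     : ∀ a b → adj G (to a) (to b) ≡ adj X a b

record TwoRegularC4Free {m} (G : Graph m) : Set where
  field
    neighbours : ∀ x → ExactlyTwo (adj G x)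
    no-C4 : ∀ {x y a b} → x ≢ y → a ≢ b → adj G x a ≡ true → adj G x b ≡ true →
            adj G y a ≡ true → adj G y b ≡ true → ⊥

-- rest is G with the components covered by E removed.
module Residual {k m} {X : Graph k} {G : Graph m} (E : ComponentEmbedding X G) where

  open ComponentEmbedding E

  outside : Fin m → Bool
  outside y = not ⌊ any? (λ a → embed a ≟ y) ⌋

  outside-embed : ∀ a → outside (embed a) ≡ false
  outside-embed a with any? (λ a′ → embed a′ ≟ embed a)
  ... | yes _     = refl
  ... | no ¬image = ⊥-elim (¬image (a , refl))

  outside⇒≢embed : ∀ y → outside y ≡ true → ∀ a → embed a ≢ y
  outside⇒≢embed y out a eq with any? (λ a′ → embed a′ ≟ y)
  ... | yes _     with () ← out
  ... | no ¬image = ¬image (a , eq)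

  ¬outside⇒embed : ∀ y → outside y ≡ false → Σ (Fin k) λ a → embed a ≡ y
  ¬outside⇒embed y ¬out with any? (λ a′ → embed a′ ≟ y)
  ... | yes image = image
  ... | no _      with () ← ¬out

  size : ℕ
  size = count outside

  incl : Fin size → Fin m
  incl = enumerate outside

  incl-injective : Injective _≡_ _≡_ incl
  incl-injective = enumerate-injective outside

  rest : Graph size
  rest = record
    { adj = λ i j → adj G (incl i) (incl j)
    ; adj-sym = λ i j → adj-sym G (incl i) (incl j)
    ; adj-irrefl = λ i → adj-irrefl G (incl i) }

  embed≢incl : ∀ a i → embed a ≢ incl i
  embed≢incl a i = outside⇒≢embed (incl i) (enumerate-true outside i) a

  ¬adj-embed-incl : ∀ a i → adj G (embed a) (incl i) ≡ false
  ¬adj-embed-incl a i with adj G (embed a) (incl i) in gai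
  ... | false = refl
  ... | true with closed a (incl i) gai
  ...   | b , eq = ⊥-elim (embed≢incl b i eq)

  incl-closed : ∀ i y → adj G (incl i) y ≡ true → Σ (Fin size) λ j → incl j ≡ y
  incl-closed i y giy with outside y in out
  ... | true  = enumerate-surjective outside y out
  ... | false with ¬outside⇒embed y out
  ...   | a , refl with () ← trans (sym (¬adj-embed-incl a i)) (trans (adj-sym G (embed a) (incl i)) giy)

  neighbours-rest : ∀ i → ExactlyTwo (adj G (incl i)) → ExactlyTwo (adj rest i)
  neighbours-rest i T = record
    { x = x′ ; y = y′ ; x≢y = λ eq → x≢y (trans (sym incl-x′) (trans (cong incl eq) incl-y′))
    ; fx = trans (cong (adj G (incl i)) incl-x′) fx ; fy = trans (cong (adj G (incl i)) incl-y′) fy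
    ; only = only′ }
    where
    open ExactlyTwo T
    open Σ (incl-closed i x fx) renaming (proj₁ to x′; proj₂ to incl-x′)
    open Σ (incl-closed i y fy) renaming (proj₁ to y′; proj₂ to incl-y′)
    only′ : ∀ c → adj rest i c ≡ true → c ≡ x′ ⊎ c ≡ y′
    only′ c ric = Data.Sum.map (λ eq → incl-injective (trans eq (sym incl-x′)))
                               (λ eq → incl-injective (trans eq (sym incl-y′))) (only (incl c) ric)

  rest-twoRegularC4Free : (∀ i → ExactlyTwo (adj G (incl i))) →
    (∀ {i j a b} → i ≢ j → incl a ≢ incl b → adj G (incl i) (incl a) ≡ true → adj G (incl i) (incl b) ≡ true →
       adj G (incl j) (incl a) ≡ true → adj G (incl j) (incl b) ≡ true → ⊥) →
    TwoRegularC4Free rest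
  rest-twoRegularC4Free neighbours no-C4 = record
    { neighbours = λ i → neighbours-rest i (neighbours i)
    ; no-C4 = λ i≢j a≢b → no-C4 i≢j (a≢b ∘ incl-injective) }

  size<m : 1 ≤ k → size < m
  size<m (s≤s _) = begin-strict
    size                              <⟨ m<m+n size (s≤s z≤n) ⟩
    size + 1                          ≤⟨ +-monoʳ-≤ size (injection⇒≤count (not ∘ outside) (λ (_ : Fin 1) → embed zero)
                                          (λ { {zero} {zero} _ → refl }) (λ _ → cong not (outside-embed zero))) ⟩
    size + count (not ∘ outside)      ≡⟨ count-+-count-not outside ⟩
    m                                 ∎
    where open ≤-Reasoning

  ⊕-bijection : ∀ {l} {Y : Graph l} → GraphBijection Y rest → GraphBijection (X ⊕ Y) G
  ⊕-bijection {l} {Y} B = record { to = to′ ; injective = injective′ ; surjective = surjective′ ; adj-to = adj-to′ }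
    where
    module B = GraphBijection B
    to′ : Fin (k + l) → Fin m
    to′ i = [ embed , incl ∘ B.to ] (splitAt k i)
    to′-↑ˡ : ∀ a → to′ (a ↑ˡ l) ≡ embed a
    to′-↑ˡ a rewrite splitAt-↑ˡ k a l = refl
    to′-↑ʳ : ∀ b → to′ (k ↑ʳ b) ≡ incl (B.to b)
    to′-↑ʳ b rewrite splitAt-↑ʳ k l b = refl
    injective′ : Injective _≡_ _≡_ to′
    injective′ {i} {j} eq with splitView k l i | splitView k l j
    ... | left a  | left b  = cong (_↑ˡ l) (injective (trans (sym (to′-↑ˡ a)) (trans eq (to′-↑ˡ b))))
    ... | right a | right b = cong (k ↑ʳ_) (B.injective (incl-injective (trans (sym (to′-↑ʳ a)) (trans eq (to′-↑ʳ b)))))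
    ... | left a  | right b = ⊥-elim (embed≢incl a (B.to b) (trans (sym (to′-↑ˡ a)) (trans eq (to′-↑ʳ b))))
    ... | right a | left b  = ⊥-elim (embed≢incl b (B.to a) (trans (sym (to′-↑ˡ b)) (trans (sym eq) (to′-↑ʳ a))))
    surjective′ : ∀ y → Σ (Fin (k + l)) λ i → to′ i ≡ y
    surjective′ y with outside y in out
    ... | false with ¬outside⇒embed y out
    ...   | a , eq = a ↑ˡ l , trans (to′-↑ˡ a) eq
    surjective′ y | true with enumerate-surjective outside y out
    ...   | j , eq with B.surjective j
    ...     | b , eq′ = k ↑ʳ b , trans (to′-↑ʳ b) (trans (cong incl eq′) eq)
    adj-to′ : ∀ i j → adj G (to′ i) (to′ j) ≡ adj (X ⊕ Y) i j
    adj-to′ i j with splitView k l i | splitView k l j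
    ... | left a  | left b  = trans (cong₂ (adj G) (to′-↑ˡ a) (to′-↑ˡ b))
                                (trans (adj-embed a b) (sym (adj-⊕-↑ˡ-↑ˡ X Y a b)))
    ... | right a | right b = trans (cong₂ (adj G) (to′-↑ʳ a) (to′-↑ʳ b))
                                (trans (B.adj-to a b) (sym (adj-⊕-↑ʳ-↑ʳ X Y a b)))
    ... | left a  | right b = trans (cong₂ (adj G) (to′-↑ˡ a) (to′-↑ʳ b))
                                (trans (¬adj-embed-incl a (B.to b)) (sym (adj-⊕-↑ˡ-↑ʳ X Y a b)))
    ... | right a | left b  = trans (cong₂ (adj G) (to′-↑ʳ a) (to′-↑ˡ b))
                                (trans (adj-sym G _ _) (trans (¬adj-embed-incl b (B.to a)) (sym (adj-⊕-↑ʳ-↑ˡ X Y b a))))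

CycleDecomposition : ∀ {m} → Graph m → Set
CycleDecomposition G = Σ (List ℕ) λ l → All (λ s → 3 ≤ s × s ≢ 4) l × GraphBijection (cycles l) G

C4-component⇒¬C4Free : ∀ {m} (G : Graph m) → TwoRegularC4Free G → ¬ ComponentEmbedding (Cycle 4) G
C4-component⇒¬C4Free G G-C4free E = TwoRegularC4Free.no-C4 G-C4free
  (0≢2 ∘ injective) (1≢3 ∘ injective) (adj-embed v0 v1) (adj-embed v0 v3) (adj-embed v2 v1) (adj-embed v2 v3)
  where
  open ComponentEmbedding E
  v0 v1 v2 v3 : Fin 4
  v0 = zero
  v1 = suc zero
  v2 = suc (suc zero)
  v3 = suc (suc (suc zero))
  0≢2 : v0 ≢ v2
  0≢2 ()
  1≢3 : v1 ≢ v3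
  1≢3 ()

cycle-decomposition : ∀ fuel {m} → m ≤ fuel → (G : Graph m) → TwoRegularC4Free G → CycleDecomposition G
cycle-decomposition fuel {zero} _ G _ = [] , [] , record
  { to = λ () ; injective = λ { {()} } ; surjective = λ () ; adj-to = λ () }
cycle-decomposition (suc fuel) {suc m} (s≤s m≤fuel) G G-C4free
  with Walk.start G (TwoRegularC4Free.neighbours G-C4free) refl
... | t , 2≤t , E = suc t ∷ l , (s≤s 2≤t , s≢4) ∷ l-ok , ⊕-bijection B
  where
  open Residual E
  s≢4 : suc t ≢ 4
  s≢4 refl = C4-component⇒¬C4Free G G-C4free E
  rest-C4free : TwoRegularC4Free rest
  rest-C4free = rest-twoRegularC4Free (TwoRegularC4Free.neighbours G-C4free ∘ incl)
                  (λ i≢j → TwoRegularC4Free.no-C4 G-C4free (i≢j ∘ incl-injective))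
  decomposition = cycle-decomposition fuel (≤-pred (≤-trans (size<m (s≤s z≤n)) (s≤s m≤fuel))) rest rest-C4free
  l = proj₁ decomposition
  l-ok = proj₁ (proj₂ decomposition)
  B = proj₂ (proj₂ decomposition)

bijection⇒≡ : ∀ {k m} {X : Graph k} {G : Graph m} → GraphBijection X G → k ≡ m
bijection⇒≡ B = ≤-antisym (injective⇒≤ injective) (injective⇒≤ {f = λ y → proj₁ (surjective y)}
  (λ {x} {y} eq → trans (sym (proj₂ (surjective x))) (trans (cong to eq) (proj₂ (surjective y)))))
  where open GraphBijection B

bijection⇒Iso : ∀ {k m} {X : Graph k} {G : Graph m} → GraphBijection X G → Iso G X
bijection⇒Iso {X = X} {G} B = mk↔ₛ′ from to (λ a → injective (to-from (to a))) to-from , adj-from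
  where
  open GraphBijection B
  from : _ → _
  from y = proj₁ (surjective y)
  to-from : ∀ y → to (from y) ≡ y
  to-from y = proj₂ (surjective y)
  adj-from : ∀ i j → adj G i j ≡ adj X (from i) (from j)
  adj-from i j = trans (sym (cong₂ (adj G) (to-from i) (to-from j))) (adj-to (from i) (from j))

Iso-complement : ∀ {n m} (G : Graph n) (X : Graph m) → Iso G X → Iso (complement G) (complement X)
Iso-complement G X (φ , adj-φ) = φ , λ i j → begin
  adj (complement G) i j                                     ≡⟨ adj-complement G i j ⟩
  not (adj G i j) ∧ not (i ≟ᵇ j)                             ≡⟨ cong₂ (λ a b → not a ∧ not b) (adj-φ i j) (≟ᵇ-cong (cong to) to-injective) ⟩
  not (adj X (to i) (to j)) ∧ not (to i ≟ᵇ to j)             ≡⟨ adj-complement X (to i) (to j) ⟨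
  adj (complement X) (to i) (to j)                           ∎
  where
  open ≡-Reasoning
  open Inverse φ using (to)
  to-injective : Injective _≡_ _≡_ to
  to-injective {x} {y} eq = trans (sym (Inverse.strictlyInverseʳ φ x))
    (trans (cong (Inverse.from φ) eq) (Inverse.strictlyInverseʳ φ y))

Iso⇒∑degree : ∀ {n m} (G : Graph n) (X : Graph m) → Iso G X → ∑ (degree G) ≡ ∑ (degree X)
Iso⇒∑degree G X (φ , adj-φ) = trans (∑-cong degree-φ) (sym (sum-permute (degree X) φ))
  where
  degree-φ : ∀ i → degree G i ≡ degree X (Inverse.to φ i)
  degree-φ i = trans (count-cong _ _ (adj-φ i)) (sym (sum-permute (λ b → boolToℕ (adj X (Inverse.to φ i) b)) φ))

∑degree-complement-complement : ∀ {n} (G : Graph n) → ∑ (degree (complement (complement G))) ≡ ∑ (degree G)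
∑degree-complement-complement G = ∑-cong (λ i → count-cong _ _ (adj-complement-complement G i))

spread⇒no-C4 : ∀ {n} {K : Graph n} → Spread K → ∀ {x y a b} → ExactlyTwo (adj K x) → ExactlyTwo (adj K y) →
  x ≢ y → a ≢ b → adj K x a ≡ true → adj K x b ≡ true → adj K y a ≡ true → adj K y b ≡ true → ⊥
spread⇒no-C4 {K = K} spread {x} {y} {a} {b} Tx Ty x≢y a≢b xa xb ya yb =
  <⇒≱ (s≤s (s≤s (s≤s z≤n))) (≤-trans (spread x y x≢y ¬adj-xy) union≤2)
  where
  ¬adj-xy : adj K x y ≡ false
  ¬adj-xy with adj K x y in xy
  ... | false = refl
  ... | true with exactlyTwo-only Tx xa xb a≢b y xy
  ...   | inj₁ refl with () ← trans (sym (adj-irrefl K y)) ya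
  ...   | inj₂ refl with () ← trans (sym (adj-irrefl K y)) yb
  ∈ab : ∀ {z} c → ExactlyTwo (adj K z) → adj K z a ≡ true → adj K z b ≡ true → adj K z c ≡ true →
    ((a ≟ᵇ c) ∨ (b ≟ᵇ c)) ≡ true
  ∈ab c Tz za zb zc with exactlyTwo-only Tz za zb a≢b c zc
  ... | inj₁ refl = ∨-≡-trueˡ (b ≟ᵇ c) (≟ᵇ-refl c)
  ... | inj₂ refl = ∨-≡-trueʳ (a ≟ᵇ c) (≟ᵇ-refl c)
  covered : ∀ c → (adj K x c ∨ adj K y c) ≡ true → ((a ≟ᵇ c) ∨ (b ≟ᵇ c)) ≡ true
  covered c xc∨yc with ∨-≡-true {adj K x c} xc∨yc
  ... | inj₁ xc = ∈ab c Tx xa xb xc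
  ... | inj₂ yc = ∈ab c Ty ya yb yc
  union≤2 : count (λ c → adj K x c ∨ adj K y c) ≤ 2
  union≤2 = begin
    count (λ c → adj K x c ∨ adj K y c)    ≤⟨ count-mono _ _ covered ⟩
    count (λ c → (a ≟ᵇ c) ∨ (b ≟ᵇ c))      ≤⟨ count-∨ (a ≟ᵇ_) (b ≟ᵇ_) ⟩
    count (a ≟ᵇ_) + count (b ≟ᵇ_)          ≡⟨ cong₂ _+_ (count-≟ᵇ a) (count-≟ᵇ b) ⟩
    2                                      ∎
    where open ≤-Reasoning

-- The pendant edge uw is a K₂-component; the rest is 2-regular, and C₄-free because K is spread.
extremal⇒decomposition : ∀ {n} (K : Graph n) → Spread K → ExtremalProfile K →
  Σ (List ℕ) λ l → All (λ s → 3 ≤ s × s ≢ 4) l × GraphBijection (K2 ⊕ cycles l) K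
extremal⇒decomposition {n} K spread P = l , l-ok , ⊕-bijection B
  where
  open ExtremalProfile P
  g : Fin 2 → Fin n
  g zero       = u
  g (suc zero) = w
  E : ComponentEmbedding K2 K
  E = record { embed = g ; injective = g-injective ; adj-embed = adj-g ; closed = closed }
    where
    g-injective : Injective _≡_ _≡_ g
    g-injective {zero}     {zero}     _  = refl
    g-injective {zero}     {suc zero} eq = ⊥-elim (u≢w eq)
    g-injective {suc zero} {zero}     eq = ⊥-elim (u≢w (sym eq))
    g-injective {suc zero} {suc zero} _  = refl
    adj-g : ∀ a b → adj K (g a) (g b) ≡ adj K2 a b
    adj-g zero       zero       = adj-irrefl K u
    adj-g zero       (suc zero) = adj-uw
    adj-g (suc zero) zero       = trans (adj-sym K w u) adj-uw
    adj-g (suc zero) (suc zero) = adj-irrefl K w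
    only-neighbour : ∀ {x z} → degree K x ≡ 1 → adj K x z ≡ true → ∀ y → adj K x y ≡ true → y ≡ z
    only-neighbour deg≡1 xz y xy with count≡1⇒unique _ deg≡1
    ... | _ , _ , unique = trans (unique y xy) (sym (unique _ xz))
    closed : ∀ a y → adj K (g a) y ≡ true → Σ (Fin 2) λ b → g b ≡ y
    closed zero       y uy = suc zero , sym (only-neighbour degree-u adj-uw y uy)
    closed (suc zero) y wy = zero , sym (only-neighbour degree-w (trans (adj-sym K w u) adj-uw) y wy)
  open Residual E
  neighbours : ∀ i → ExactlyTwo (adj K (incl i))
  neighbours i = count≡2⇒exactlyTwo _ (degree-other (incl i) (embed≢incl zero i ∘ sym) (embed≢incl (suc zero) i ∘ sym))
  decomposition = cycle-decomposition size ≤-refl rest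
    (rest-twoRegularC4Free neighbours (λ {i} {j} i≢j → spread⇒no-C4 {K = K} spread (neighbours i) (neighbours j) (i≢j ∘ incl-injective)))
  l = proj₁ decomposition
  l-ok = proj₁ (proj₂ decomposition)
  B = proj₂ (proj₂ decomposition)

spread⇒∑degree≥ : ∀ {n} (K : Graph n) → Spread K → n + n ≤ ∑ (degree K) + 2
spread⇒∑degree≥ {zero}  K spread = z≤n
spread⇒∑degree≥ {suc m} K spread =
  ≤-trans (≤-reflexive (sym (m+m+2≡1+m+1+m m))) (+-monoˡ-≤ 2 (SpreadDegrees.2m≤∑degree K spread))

spread∧∑degree≡⇒extremal : ∀ {n} (K : Graph n) → Spread K → 2 ≤ n → ∑ (degree K) + 2 ≡ n + n → ExtremalProfile K
spread∧∑degree≡⇒extremal {suc m} K spread (s≤s 1≤m) ∑+2≡2n = SpreadDegrees.∑degree≡2m⇒extremal K spread 1≤m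
  (+-cancelʳ-≡ 2 (∑ (degree K)) (m + m) (trans ∑+2≡2n (sym (m+m+2≡1+m+1+m m))))

Spread-cong : ∀ {n} (K K′ : Graph n) → (∀ x y → adj K x y ≡ adj K′ x y) → Spread K′ → Spread K
Spread-cong K K′ K≗K′ spread u v u≢v ¬adj-uv =
  subst (3 ≤_) (sym (count-cong _ _ (λ w → cong₂ _∨_ (K≗K′ u w) (K≗K′ v w))))
    (spread u v u≢v (trans (sym (K≗K′ u v)) ¬adj-uv))

-- The witness is complement (K₂ + C_{t+1}), transported to any n = t + 3.
extremal-graph : ∀ t → 4 ≤ t → ∀ {n} → 2 + suc t ≡ n →
  Σ (Graph n) λ W → Spread (complement W) × ∑ (degree (complement W)) + 2 ≡ n + n
extremal-graph t 4≤t refl = complement M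
  , Spread-cong (complement (complement M)) M (adj-complement-complement M) (K2⊕CycleSpread.spread t 4≤t)
  , (begin
      ∑ (degree (complement (complement M))) + 2   ≡⟨ cong (_+ 2) (∑degree-complement-complement M) ⟩
      ∑ (degree M) + 2                             ≡⟨ cong (_+ 2) (∑degree-K2⊕ (Cycle (suc t)) (degree-Cycle t (≤-trans (s≤s (s≤s z≤n)) 4≤t))) ⟩
      2 + (suc t + suc t) + 2                      ≡⟨ 2+[k+k]+2≡[2+k]+[2+k] (suc t) ⟩
      (2 + suc t) + (2 + suc t)                    ∎)
  where
  open ≡-Reasoning
  M = K2 ⊕ Cycle (suc t)
  2+[k+k]+2≡[2+k]+[2+k] : ∀ k → 2 + (k + k) + 2 ≡ (2 + k) + (2 + k)
  2+[k+k]+2≡[2+k]+[2+k] = solve-∀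

-- Both sides of edges-complement equal n * n, so twice the size plus the complement's degree sum is invariant.
∑degree-complement-≤⇒edges-≥ : ∀ {n} (G G′ : Graph n) →
  ∑ (degree (complement G′)) ≤ ∑ (degree (complement G)) → edges G ≤ edges G′
∑degree-complement-≤⇒edges-≥ {n} G G′ D′≤D = ≮⇒≥ λ e′<e → <⇒≱ (+-mono-<-≤ (+-mono-< e′<e e′<e) D′≤D) (≤-reflexive same)
  where
  same : edges G + edges G + ∑ (degree (complement G)) ≡ edges G′ + edges G′ + ∑ (degree (complement G′))
  same = +-cancelʳ-≡ n _ _ (trans (edges-complement G) (sym (edges-complement G′)))

edges-≤⇒∑degree-complement-≥ : ∀ {n} (G G′ : Graph n) →
  edges G ≤ edges G′ → ∑ (degree (complement G′)) ≤ ∑ (degree (complement G))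
edges-≤⇒∑degree-complement-≥ {n} G G′ e≤e′ = ≮⇒≥ λ D<D′ → <⇒≱ (+-mono-≤-< (+-mono-≤ e≤e′ e≤e′) D<D′) (≤-reflexive same)
  where
  same : edges G′ + edges G′ + ∑ (degree (complement G′)) ≡ edges G + edges G + ∑ (degree (complement G))
  same = +-cancelʳ-≡ n _ _ (trans (edges-complement G′) (sym (edges-complement G)))

complement-Iso⇒Iso : ∀ {n m} (H : Graph n) (M : Graph m) → Iso (complement H) M → Iso H (complement M)
complement-Iso⇒Iso H M iso with Iso-complement (complement H) M iso
... | φ , adj-φ = φ , λ i j → trans (sym (adj-complement-complement H i j)) (adj-φ i j)

extremal⇒complement-of-cycles : ∀ {n} (H : Graph n) → Spread (complement H) → 2 ≤ n →
  ∑ (degree (complement H)) + 2 ≡ n + n →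
  Σ (List ℕ) λ l → All (λ s → 3 ≤ s × s ≢ 4) l × 2 + sum l ≡ n × Iso H (complement (K2 ⊕ cycles l))
extremal⇒complement-of-cycles H spread 2≤n ∑+2≡2n
  with extremal⇒decomposition (complement H) spread (spread∧∑degree≡⇒extremal (complement H) spread 2≤n ∑+2≡2n)
... | l , l-ok , B = l , l-ok , bijection⇒≡ B , complement-Iso⇒Iso H (K2 ⊕ cycles l) (bijection⇒Iso B)

complement-of-cycles⇒∑degree : ∀ {n} (H : Graph n) l → All (3 ≤_) l → Iso H (complement (K2 ⊕ cycles l)) →
  ∑ (degree (complement H)) ≡ 2 + (sum l + sum l)
complement-of-cycles⇒∑degree H l 3≤l iso = begin
  ∑ (degree (complement H))                              ≡⟨ Iso⇒∑degree (complement H) (complement (complement M))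
                                                              (Iso-complement H (complement M) iso) ⟩
  ∑ (degree (complement (complement M)))                 ≡⟨ ∑degree-complement-complement M ⟩
  ∑ (degree M)                                           ≡⟨ ∑degree-K2⊕ (cycles l) (degree-cycles l 3≤l) ⟩
  2 + (sum l + sum l)                                    ∎
  where
  open ≡-Reasoning
  M = K2 ⊕ cycles l

edges≡ex⇔∑degree-complement≡ : ∀ p → 3 ≤ p → ∀ e → IsEx (p + 4) (Book p) e →
  ∀ G → ¬ Contains G (Book p) → edges G ≡ e ⇔ ∑ (degree (complement G)) + 2 ≡ (p + 4) + (p + 4)
edges≡ex⇔∑degree-complement≡ p 3≤p e ((G₀ , G₀-free , edges-G₀≡e) , maximum) G G-free = mk⇔
  (λ edges≡e → ≤-antisym (≤-trans (+-monoˡ-≤ 2 (edges-≤⇒∑degree-complement-≥ W G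
                            (≤-reflexive (trans (sym e≡edges-W) (sym edges≡e))))) (≤-reflexive W-extremal))
                         (lower G G-free))
  (λ ∑+2≡2n → ≤-antisym (maximum G G-free)
    (subst (_≤ edges G) (sym e≡edges-W) (∑degree-complement-≤⇒edges-≥ W G
      (+-cancelʳ-≤ 2 _ _ (≤-trans (≤-reflexive ∑+2≡2n) (lower W W-free))))))
  where
  n = p + 4
  lower : ∀ G → ¬ Contains G (Book p) → n + n ≤ ∑ (degree (complement G)) + 2
  lower G free = spread⇒∑degree≥ (complement G) (bookFree⇒spread p G free)
  witness = extremal-graph (p + 1) (≤-trans (s≤s 3≤p) (≤-reflexive (+-comm 1 p))) (2+[p+1+1]≡p+4 p)
    where
    2+[p+1+1]≡p+4 : ∀ p → 2 + suc (p + 1) ≡ p + 4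
    2+[p+1+1]≡p+4 = solve-∀
  W : Graph n
  W = proj₁ witness
  W-extremal : ∑ (degree (complement W)) + 2 ≡ n + n
  W-extremal = proj₂ (proj₂ witness)
  W-free : ¬ Contains W (Book p)
  W-free = spread⇒bookFree p W (proj₁ (proj₂ witness))
  e≡edges-W : e ≡ edges W
  e≡edges-W = ≤-antisym
    (subst (_≤ edges W) edges-G₀≡e (∑degree-complement-≤⇒edges-≥ G₀ W
      (+-cancelʳ-≤ 2 _ _ (≤-trans (≤-reflexive W-extremal) (lower G₀ G₀-free)))))
    (maximum W W-free)

theorem7 : (p : ℕ) → 3 ≤ p → (H : Graph (p + 4)) → ¬ Contains H (Book p) →
    (e : ℕ) → IsEx (p + 4) (Book p) e →
    (edges H ≡ e ⇔
    Σ (List ℕ) λ l → All (λ s → 3 ≤ s × s ≢ 4) l × sum l ≡ p + 2 ×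
    Iso H (complement (K2 ⊕ cycles l)))
theorem7 p 3≤p H H-free e ex = mk⇔ to from
  where
  open Equivalence (edges≡ex⇔∑degree-complement≡ p 3≤p e ex H H-free) renaming (to to tight; from to maximal)
  ComplementOfCycles : Set
  ComplementOfCycles = Σ (List ℕ) λ l → All (λ s → 3 ≤ s × s ≢ 4) l × sum l ≡ p + 2 ×
                         Iso H (complement (K2 ⊕ cycles l))
  to : edges H ≡ e → ComplementOfCycles
  to edges≡e = reshape (extremal⇒complement-of-cycles H (bookFree⇒spread p H H-free)
                          (≤-trans (s≤s (s≤s z≤n)) (m≤n+m 4 p)) (tight edges≡e))
    where
    p+4≡2+[p+2] : ∀ p → p + 4 ≡ 2 + (p + 2)
    p+4≡2+[p+2] = solve-∀
    reshape : (Σ (List ℕ) λ l → All (λ s → 3 ≤ s × s ≢ 4) l × 2 + sum l ≡ p + 4 × Iso H (complement (K2 ⊕ cycles l))) →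
              ComplementOfCycles
    reshape (l , l-ok , 2+sum≡n , iso) = l , l-ok , +-cancelˡ-≡ 2 (sum l) (p + 2) (trans 2+sum≡n (p+4≡2+[p+2] p)) , iso
  from : ComplementOfCycles → edges H ≡ e
  from (l , l-ok , sum≡p+2 , iso) = maximal (begin
    ∑ (degree (complement H)) + 2   ≡⟨ cong (_+ 2) (complement-of-cycles⇒∑degree H l (All-map proj₁ l-ok) iso) ⟩
    2 + (sum l + sum l) + 2         ≡⟨ cong (λ k → 2 + (k + k) + 2) sum≡p+2 ⟩
    2 + ((p + 2) + (p + 2)) + 2     ≡⟨ arithmetic p ⟩
    (p + 4) + (p + 4)               ∎)
    where
    open ≡-Reasoning
    arithmetic : ∀ p → 2 + ((p + 2) + (p + 2)) + 2 ≡ (p + 4) + (p + 4)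
    arithmetic = solve-∀
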